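{- Let $q$ be a prime power and let $\Delta=([\ell],\mathcal{F})$ be a simplicial complex on vertex set $[\ell]$. For a simplicial complex $\Delta'$ on a vertex set $V$, let $\mathcal{S}_{\Delta'}^q$ denote the arrangement in $\mathbb{F}_q^{V}$ (coordinates $x_v$, $v\in V$) $$\mathcal{S}_{\Delta'}^q=\bigcup_{\{i_1,\dots,i_r\}\text{ a nonempty face of }\Delta'}\{\ker(a_{i_1}x_{i_1}+\dots+a_{i_r}x_{i_r})\mid a_{i_j}\in\mathbb{F}_q^\times\text{ for all } j\}.$$ Suppose $e=\{i_1,i_2\}$ is an edge of the underlying graph of $\Delta$ (i.e. a $2$-element face) and that $e$ is a maximal face of $\Delta$. Let $\Delta\setminus e$ be the simplicial complex on $[\ell]$ obtained by removing the face $e$, and let $\Delta/e$ be the simplicial complex on the $(\ell-1)$-element vertex set obtained from $[\ell]$ by identifying $i_1$ and $i_2$, whose faces are the images of the faces of $\Delta$ under this identification. Then $$\chi(\mathcal{S}_\Delta^q,t)=\chi(\mathcal{S}_{\Delta\setminus e}^q,t)-(q-1)\,\chi(\mathcal{S}_{\Delta/e}^q,t).$$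
   Context: A simplicial complex $(V,\mathcal{F})$ has face set $\mathcal{F}\subseteq 2^V$ closed under subsets, every vertex being a face. Its underlying graph has the $2$-element faces as edges. For a central arrangement $\mathcal{A}$ in $\mathbb{K}^n$, $\chi(\mathcal{A},t)=\sum_{\mathcal{B}\subseteq\mathcal{A}}(-1)^{|\mathcal{B}|}t^{\dim\bigcap_{H\in\mathcal{B}}H}$, with the empty intersection equal to $\mathbb{K}^n$. -}

module Defs where

open import Level using (0ℓ)
open import Algebra.Bundles using (CommutativeRing)
open import Data.Bool using (Bool; true; false; _∧_; _∨_; not; if_then_else_; T)
open import Data.Nat using (ℕ; zero; suc; _⊔_; _∸_)
import Data.Nat as ℕ
open import Data.Integer using (ℤ; +_)
import Data.Integer as ℤ
open import Data.Fin using (Fin)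
open import Data.Fin.Subset using (Subset; _⊆_; ⁅_⁆; _∪_; _∈_; Nonempty)
import Data.Fin.Properties as FinP
open import Data.List using (List; []; _∷_; map; concatMap; filter; length; foldr; upTo; allFin; deduplicateᵇ)
import Data.List as L
open import Data.List.Relation.Unary.Any using (Any)
open import Data.List.Relation.Unary.AllPairs using (AllPairs)
open import Data.Vec using (Vec; []; _∷_; lookup; tabulate)
import Data.Vec.Properties as VecP
import Data.Bool.Properties as BoolP
import Data.Vec.Functional as VF
open import Data.Product using (Σ; ∃; _×_)
open import Data.Sum using (_⊎_)
open import Relation.Nullary using (¬_; does)
open import Relation.Binary using (Decidable)
open import Relation.Binary.PropositionalEquality using (_≡_)

-- Its order q is the length of that list (necessarily a
-- prime power; every prime power arises, F_q being unique up to iso).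

record FiniteField : Set₁ where
  field
    commRing : CommutativeRing 0ℓ 0ℓ
  open CommutativeRing commRing public
  field
    _≈?_     : Decidable _≈_
    1≉0      : ¬ (1# ≈ 0#)
    inverse  : ∀ x → ¬ (x ≈ 0#) → Σ Carrier (λ y → x * y ≈ 1#)
    elems    : List Carrier
    complete : ∀ x → Any (x ≈_) elems
    distinct : AllPairs (λ x y → ¬ (x ≈ y)) elems

  order : ℕ
  order = length elems

tuples : {A : Set} → List A → (k : ℕ) → List (Fin k → A)
tuples xs zero    = (λ ()) ∷ []
tuples xs (suc k) = concatMap (λ a → map (λ v → a VF.∷ v) (tuples xs k)) xs

allSubsets : (n : ℕ) → List (Subset n)
allSubsets zero    = [] ∷ []
allSubsets (suc n) = concatMap (λ s → (false ∷ s) ∷ (true ∷ s) ∷ []) (allSubsets n)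

sublists : {A : Set} → List A → List (List A)
sublists []       = [] ∷ []
sublists (x ∷ xs) = let r = sublists xs in r L.++ map (x ∷_) r

anyL allL : {A : Set} → (A → Bool) → List A → Bool
anyL p = foldr (λ a b → p a ∨ b) false
allL p = foldr (λ a b → p a ∧ b) true

subsetEq : {n : ℕ} → Subset n → Subset n → Bool
subsetEq s t = does (VecP.≡-dec BoolP._≟_ s t)

isNonempty : {n : ℕ} → Subset n → Bool
isNonempty {n} s = anyL (λ i → lookup s i) (allFin n)

record IsSimplicialComplex {ℓ : ℕ} (face : Subset ℓ → Bool) : Set where
  field
    downClosed : ∀ σ τ → τ ⊆ σ → T (face σ) → T (face τ)
    vertices   : ∀ i → T (face ⁅ i ⁆)

deleteFace : {ℓ : ℕ} → (Subset ℓ → Bool) → Subset ℓ → (Subset ℓ → Bool)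
deleteFace face e σ = face σ ∧ not (subsetEq σ e)

image : {ℓ m : ℕ} → (Fin ℓ → Fin m) → Subset ℓ → Subset m
image {ℓ} π σ = tabulate (λ j → anyL (λ i → lookup σ i ∧ does (π i FinP.≟ j)) (allFin ℓ))

contract : {ℓ m : ℕ} → (Fin ℓ → Fin m) → (Subset ℓ → Bool) → (Subset m → Bool)
contract {ℓ} π face τ = anyL (λ σ → face σ ∧ subsetEq (image π σ) τ) (allSubsets ℓ)

record IsIdentification {ℓ m : ℕ} (i₁ i₂ : Fin ℓ) (π : Fin ℓ → Fin m) : Set where
  field
    glues      : π i₁ ≡ π i₂
    onlyGlues  : ∀ i j → π i ≡ π j → (i ≡ j) ⊎ ((i ≡ i₁ ⊎ i ≡ i₂) × (j ≡ i₁ ⊎ j ≡ i₂))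
    surjective : ∀ k → ∃ λ i → π i ≡ k

module Arrangement (F : FiniteField) where
  open FiniteField F

  isZero : Carrier → Bool
  isZero x = does (x ≈? 0#)

  Vector : ℕ → Set
  Vector n = Fin n → Carrier

  allVecs : (n : ℕ) → List (Vector n)
  allVecs n = tuples elems n

  sumF : {k : ℕ} → (Fin k → Carrier) → Carrier
  sumF {zero}  f = 0#
  sumF {suc k} f = f Fin.zero + sumF (λ i → f (Fin.suc i))

  dot : {n : ℕ} → Vector n → Vector n → Carrier
  dot a x = sumF (λ i → a i * x i)

  isZeroVec : {n : ℕ} → Vector n → Bool
  isZeroVec {n} v = allL (λ i → isZero (v i)) (allFin n)

  supportedExactlyOn : {n : ℕ} → Subset n → Vector n → Bool
  supportedExactlyOn {n} σ a =
    allL (λ i → if lookup σ i then not (isZero (a i)) else isZero (a i)) (allFin n)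

  forms : {n : ℕ} → (Subset n → Bool) → List (Vector n)
  forms {n} face =
    concatMap (λ σ → if face σ ∧ isNonempty σ
                       then filter (λ a → T? (supportedExactlyOn σ a)) (allVecs n)
                       else [])
              (allSubsets n)
    where open import Relation.Nullary.Decidable using (T?)

  sameKernel : {n : ℕ} → Vector n → Vector n → Bool
  sameKernel {n} a b =
    allL (λ x → does (BoolP._≟_ (isZero (dot a x)) (isZero (dot b x)))) (allVecs n)

  -- the arrangement S_Δ^q as a list of distinct hyperplanes
  -- (each hyperplane represented by one defining form)
  arrangement : {n : ℕ} → (Subset n → Bool) → List (Vector n)
  arrangement face = deduplicateᵇ sameKernel (forms face)

  inIntersection : {n : ℕ} → List (Vector n) → Vector n → Bool
  inIntersection B x = allL (λ a → isZero (dot a x)) B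

  independent : {n k : ℕ} → (Fin k → Vector n) → Bool
  independent {n} {k} vs =
    allL (λ c → not (isZeroVec (λ j → sumF (λ i → c i * vs i j)))
                ∨ allL (λ i → isZero (c i)) (allFin k))
         (tuples elems k)

  -- dimension of a subspace W ⊆ F^n: maximal size of an independent family in W
  dim : {n : ℕ} → (Vector n → Bool) → ℕ
  dim {n} W =
    foldr _⊔_ 0
      (map (λ k → if anyL (λ vs → allL (λ i → W (vs i)) (allFin k) ∧ independent vs)
                          (tuples (allVecs n) k)
                    then k else 0)
           (upTo (suc n)))

  sign : ℕ → ℤ
  sign zero    = + 1
  sign (suc m) = ℤ.- sign m

  -- coefficient of t^d in χ(S_Δ^q, t) = Σ_{B ⊆ A} (-1)^{|B|} t^{dim ∩B}
  chiCoeff : {n : ℕ} → (Subset n → Bool) → ℕ → ℤ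
  chiCoeff face d =
    foldr ℤ._+_ (+ 0)
      (map (λ B → if does (dim (inIntersection B) ℕ.≟ d) then sign (length B) else + 0)
           (sublists (arrangement face)))

module Submission where

-- Write χ(L, W) for the characteristic polynomial of the arrangement L restricted to the
-- subspace W.  It satisfies deletion–restriction, χ(L ∪ {H}, W) = χ(L, W) − χ(L, W ∩ H), and
-- is unchanged by adding a hyperplane that already occurs in L on W.  The hyperplanes of S_Δ
-- are those of S_{Δ∖e} together with the q − 1 hyperplanes H_b : x_{i₁} + b x_{i₂} = 0
-- (b ≠ 0).  Deleting the H_b one at a time, inside H_b every other H_{b′} cuts out the same
-- subspace as x_{i₁} = 0, which is a hyperplane of S_{Δ∖e}; so each step subtracts
-- χ(S_{Δ∖e}, H_b).  Finally H_b ≅ F_q^{ℓ-1} by a linear map which, because e is the only face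
-- containing both i₁ and i₂, carries the restriction of S_{Δ∖e} to H_b onto S_{Δ/e}; so
-- χ(S_{Δ∖e}, H_b) = χ(S_{Δ/e}).

open import Defs
open import Data.Bool using (Bool; true; false; _∧_; _∨_; not; if_then_else_; T)
open import Data.Bool.Properties using (T-≡; T-not-≡; T-∧; T-∨; ∧-assoc; ∧-comm) renaming (_≟_ to _≟ᵇ_)
open import Data.Unit using (tt)
open import Data.Empty using (⊥-elim)
open import Data.Nat as ℕ using (ℕ; zero; suc; _⊔_; _∸_)
import Data.Nat.Properties as ℕₚ
import Data.Integer as ℤ
import Data.Integer.Properties as ℤₚ
open import Data.Integer.Solver using (module +-*-Solver)
open import Data.Fin as Fin using (Fin; punchIn; punchOut)
import Data.Fin.Properties as Finₚ
import Data.Fin.Permutation as FinPerm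
open import Data.Fin.Subset as Sub using (Subset; _⊆_; ⁅_⁆; _∪_)
import Data.Fin.Subset.Properties as Subₚ
open import Data.Vec using (Vec; []; _∷_; lookup)
import Data.Vec.Properties as Vecₚ
import Data.Vec.Functional as VF
import Data.Vec.Functional.Properties as VFₚ
open import Data.List using (List; []; _∷_; map; filter; length; foldr; upTo; allFin; deduplicateᵇ; _++_)
import Data.List.Properties as Listₚ
open import Data.List.Membership.Propositional using (_∈_; find; lose)
open import Data.List.Membership.Propositional.Properties
open import Data.List.Relation.Unary.Any using (Any; here; there)
import Data.List.Relation.Unary.All as All
open import Data.List.Relation.Unary.AllPairs using (AllPairs; []; _∷_)
import Data.List.Relation.Unary.AllPairs.Properties as AllPairsₚ
open import Data.List.Relation.Binary.Permutation.Propositional as ↭ using (_↭_)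
import Data.List.Relation.Binary.Permutation.Propositional.Properties as ↭ₚ
open import Data.Product using (∃; _×_; _,_; proj₁; proj₂)
open import Data.Sum using (_⊎_; inj₁; inj₂; [_,_]′)
open import Function using (_∘_; Equivalence)
open import Relation.Nullary using (¬_; Dec; does; yes; no; ¬?)
open import Relation.Nullary.Decidable using (T?; dec-true; dec-false)
open import Relation.Binary.PropositionalEquality as ≡ using (_≡_; _≢_; refl; cong; cong₂; subst)

import Relation.Binary.Reasoning.Setoid as SetoidReasoning

open Equivalence using (to; from)

T-ext : ∀ {a b} → (T a → T b) → (T b → T a) → a ≡ b
T-ext {false} {false} _ _ = refl
T-ext {false} {true}  _ g = ⊥-elim (g tt)
T-ext {true}  {false} f _ = ⊥-elim (f tt)
T-ext {true}  {true}  _ _ = refl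

T-not-elim : ∀ {b} → T (not b) → ¬ T b
T-not-elim {false} _ ()

if-true : {A : Set} {b : Bool} {x y : A} → T b → (if b then x else y) ≡ x
if-true {b = true} _ = refl

if-false : {A : Set} {b : Bool} {x y : A} → ¬ T b → (if b then x else y) ≡ y
if-false {b = true}  ¬b = ⊥-elim (¬b tt)
if-false {b = false} _  = refl

does⁻ : {P : Set} (p? : Dec P) → T (does p?) → P
does⁻ (yes p) _ = p

does⁺ : {P : Set} (p? : Dec P) → P → T (does p?)
does⁺ p? p = from T-≡ (dec-true p? p)

not-does⁺ : {P : Set} (p? : Dec P) → ¬ P → T (not (does p?))
not-does⁺ p? ¬p = from T-not-≡ (dec-false p? ¬p)

module _ {A : Set} where

  anyL⁻ : (p : A → Bool) (xs : List A) → T (anyL p xs) → ∃ λ x → x ∈ xs × T (p x)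
  anyL⁻ p (x ∷ xs) t with to T-∨ t
  ... | inj₁ px = x , here refl , px
  ... | inj₂ r with anyL⁻ p xs r
  ... | y , y∈ , py = y , there y∈ , py

  anyL⁺ : (p : A → Bool) {xs : List A} {x : A} → x ∈ xs → T (p x) → T (anyL p xs)
  anyL⁺ p {y ∷ _} (here refl) px = from T-∨ (inj₁ px)
  anyL⁺ p {y ∷ _} (there x∈) px  = from T-∨ (inj₂ (anyL⁺ p x∈ px))

  allL⁻ : (p : A → Bool) {xs : List A} {x : A} → T (allL p xs) → x ∈ xs → T (p x)
  allL⁻ p t (here refl) = proj₁ (to T-∧ t)
  allL⁻ p t (there x∈)  = allL⁻ p (proj₂ (to T-∧ t)) x∈

  allL⁺ : (p : A → Bool) (xs : List A) → (∀ {x} → x ∈ xs → T (p x)) → T (allL p xs)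
  allL⁺ p []       _ = tt
  allL⁺ p (x ∷ xs) h = from T-∧ (h (here refl) , allL⁺ p xs (h ∘ there))

  anyL-cong : {p q : A → Bool} (xs : List A) → (∀ {x} → x ∈ xs → p x ≡ q x) → anyL p xs ≡ anyL q xs
  anyL-cong []       _ = refl
  anyL-cong (x ∷ xs) h = cong₂ _∨_ (h (here refl)) (anyL-cong xs (h ∘ there))

  allL-cong : {p q : A → Bool} (xs : List A) → (∀ {x} → x ∈ xs → p x ≡ q x) → allL p xs ≡ allL q xs
  allL-cong []       _ = refl
  allL-cong (x ∷ xs) h = cong₂ _∧_ (h (here refl)) (allL-cong xs (h ∘ there))

  allL-map : {B : Set} (p : B → Bool) (f : A → B) (xs : List A) → allL p (map f xs) ≡ allL (p ∘ f) xs
  allL-map p f []       = refl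
  allL-map p f (x ∷ xs) = cong (p (f x) ∧_) (allL-map p f xs)

  ∈-tuples⁻ : (xs : List A) (k : ℕ) {v : Fin k → A} → v ∈ tuples xs k → ∀ i → v i ∈ xs
  ∈-tuples⁻ xs (suc k) v∈
    with a , a∈ , v∈′ ← find (∈-concatMap⁻ (λ a → map (a VF.∷_) (tuples xs k)) {xs = xs} v∈)
    with w , w∈ , refl ← ∈-map⁻ (a VF.∷_) v∈′
    = λ { Fin.zero → a∈ ; (Fin.suc i) → ∈-tuples⁻ xs k w∈ i }

  tuples-pointwise : (xs : List A) (k : ℕ) (R : A → A → Set) (f : Fin k → A)
    → (∀ i → ∃ λ x → x ∈ xs × R (f i) x)
    → ∃ λ g → g ∈ tuples xs k × (∀ i → R (f i) (g i))
  tuples-pointwise xs zero    R f h = (λ ()) , here refl , λ ()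
  tuples-pointwise xs (suc k) R f h
    with a , a∈ , fa ← h Fin.zero
       | g , g∈ , fg ← tuples-pointwise xs k R (f ∘ Fin.suc) (h ∘ Fin.suc)
    = a VF.∷ g
    , ∈-concatMap⁺ (λ a → map (a VF.∷_) (tuples xs k)) {xs = xs} (lose a∈ (∈-map⁺ (a VF.∷_) g∈))
    , λ { Fin.zero → fa ; (Fin.suc i) → fg i }

  sublists-map : {B : Set} (f : A → B) (xs : List A) → sublists (map f xs) ≡ map (map f) (sublists xs)
  sublists-map f []       = refl
  sublists-map f (x ∷ xs) = begin
    sublists (map f xs) ++ map (f x ∷_) (sublists (map f xs))
      ≡⟨ cong (λ l → l ++ map (f x ∷_) l) (sublists-map f xs) ⟩
    map (map f) (sublists xs) ++ map (f x ∷_) (map (map f) (sublists xs))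
      ≡⟨ cong (map (map f) (sublists xs) ++_) (≡.trans (≡.sym (Listₚ.map-∘ (sublists xs))) (Listₚ.map-∘ (sublists xs))) ⟩
    map (map f) (sublists xs) ++ map (map f) (map (x ∷_) (sublists xs))
      ≡⟨ ≡.sym (Listₚ.map-++ (map f) (sublists xs) _) ⟩
    map (map f) (sublists xs ++ map (x ∷_) (sublists xs)) ∎
    where open ≡.≡-Reasoning

⊔-upTo-dropLast : (g : ℕ → ℕ) (n : ℕ) → g n ≡ 0
  → foldr _⊔_ 0 (map g (upTo (suc n))) ≡ foldr _⊔_ 0 (map g (upTo n))
⊔-upTo-dropLast g n gn≡0 = begin
  foldr _⊔_ 0 (map g (upTo (suc n)))          ≡⟨ cong (foldr _⊔_ 0 ∘ map g) (≡.sym (Listₚ.upTo-∷ʳ n)) ⟩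
  foldr _⊔_ 0 (map g (upTo n ++ n ∷ []))      ≡⟨ cong (foldr _⊔_ 0) (Listₚ.map-++ g (upTo n) (n ∷ [])) ⟩
  foldr _⊔_ 0 (map g (upTo n) ++ g n ∷ [])    ≡⟨ Listₚ.foldr-++ _⊔_ 0 (map g (upTo n)) (g n ∷ []) ⟩
  foldr _⊔_ (g n ⊔ 0) (map g (upTo n))        ≡⟨ cong (λ z → foldr _⊔_ (z ⊔ 0) (map g (upTo n))) gn≡0 ⟩
  foldr _⊔_ 0 (map g (upTo n))                ∎
  where open ≡.≡-Reasoning

T-lookup⇒∈ : ∀ {n} {σ : Subset n} {i} → T (lookup σ i) → i Sub.∈ σ
T-lookup⇒∈ {σ = σ} {i} t = Vecₚ.lookup⇒[]= i σ (to T-≡ t)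

∈⇒T-lookup : ∀ {n} {σ : Subset n} {i} → i Sub.∈ σ → T (lookup σ i)
∈⇒T-lookup i∈ = from T-≡ (Vecₚ.[]=⇒lookup i∈)

T-lookup-⁅⁆ : ∀ {n} {i j : Fin n} → T (lookup ⁅ j ⁆ i) → i ≡ j
T-lookup-⁅⁆ {j = j} t = Subₚ.x∈⁅y⁆⇒x≡y j (T-lookup⇒∈ t)

T-lookup-⁅self⁆ : ∀ {n} (j : Fin n) → T (lookup ⁅ j ⁆ j)
T-lookup-⁅self⁆ j = ∈⇒T-lookup (Subₚ.x∈⁅x⁆ j)

lookup-∪ : ∀ {n} (σ τ : Subset n) i → lookup (σ ∪ τ) i ≡ lookup σ i ∨ lookup τ i
lookup-∪ σ τ i = Vecₚ.lookup-zipWith _∨_ i σ τ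

lookup-ext : {A : Set} {n : ℕ} {u v : Vec A n} → (∀ i → lookup u i ≡ lookup v i) → u ≡ v
lookup-ext {u = u} {v} h =
  ≡.trans (≡.sym (Vecₚ.tabulate∘lookup u)) (≡.trans (Vecₚ.tabulate-cong h) (Vecₚ.tabulate∘lookup v))

subsetEq-sound : ∀ {n} {σ τ : Subset n} → T (subsetEq σ τ) → σ ≡ τ
subsetEq-sound {σ = σ} {τ} = does⁻ (Vecₚ.≡-dec _≟ᵇ_ σ τ)

subsetEq-refl : ∀ {n} (σ : Subset n) → T (subsetEq σ σ)
subsetEq-refl σ = does⁺ (Vecₚ.≡-dec _≟ᵇ_ σ σ) refl

subsetEq-≢ : ∀ {n} {σ τ : Subset n} → σ ≢ τ → T (not (subsetEq σ τ))
subsetEq-≢ {σ = σ} {τ} = not-does⁺ (Vecₚ.≡-dec _≟ᵇ_ σ τ)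

∈-allSubsets : ∀ {n} (σ : Subset n) → σ ∈ allSubsets n
∈-allSubsets [] = here refl
∈-allSubsets {suc n} (b ∷ σ) =
  ∈-concatMap⁺ (λ s → (false ∷ s) ∷ (true ∷ s) ∷ []) {xs = allSubsets n} (lose (∈-allSubsets σ) (head b))
  where
  head : ∀ b → (b ∷ σ) ∈ (false ∷ σ) ∷ (true ∷ σ) ∷ []
  head false = here refl
  head true  = there (here refl)

isNonempty⁻ : ∀ {n} (σ : Subset n) → T (isNonempty σ) → ∃ λ i → T (lookup σ i)
isNonempty⁻ {n} σ t with i , _ , i∈σ ← anyL⁻ (lookup σ) (allFin n) t = i , i∈σ

isNonempty⁺ : ∀ {n} (σ : Subset n) {i} → T (lookup σ i) → T (isNonempty σ)
isNonempty⁺ σ {i} = anyL⁺ (lookup σ) (∈-allFin i)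

module _ {ℓ m : ℕ} (π : Fin ℓ → Fin m) where

  image⁻ : ∀ σ k → T (lookup (image π σ) k) → ∃ λ i → T (lookup σ i) × π i ≡ k
  image⁻ σ k t
    with i , _ , t′ ← anyL⁻ (λ i → lookup σ i ∧ does (π i Finₚ.≟ k)) (allFin ℓ) (subst T (Vecₚ.lookup∘tabulate _ k) t)
    with i∈σ , πi≡k ← to T-∧ t′
    = i , i∈σ , does⁻ (π i Finₚ.≟ k) πi≡k

  image⁺ : ∀ σ {i} → T (lookup σ i) → T (lookup (image π σ) (π i))
  image⁺ σ {i} i∈σ = subst T (≡.sym (Vecₚ.lookup∘tabulate _ (π i)))
    (anyL⁺ (λ j → lookup σ j ∧ does (π j Finₚ.≟ π i)) (∈-allFin i) (from T-∧ (i∈σ , does⁺ (π i Finₚ.≟ π i) refl)))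

  contract⁻ : (face : Subset ℓ → Bool) (τ : Subset m) → T (contract π face τ)
    → ∃ λ σ → T (face σ) × image π σ ≡ τ
  contract⁻ face τ t
    with σ , _ , t′ ← anyL⁻ (λ σ → face σ ∧ subsetEq (image π σ) τ) (allSubsets ℓ) t
    with σ∈Δ , eq ← to T-∧ t′
    = σ , σ∈Δ , subsetEq-sound eq

  contract⁺ : (face : Subset ℓ → Bool) {σ : Subset ℓ} → T (face σ) → T (contract π face (image π σ))
  contract⁺ face {σ} σ∈Δ =
    anyL⁺ (λ σ′ → face σ′ ∧ subsetEq (image π σ′) (image π σ)) (∈-allSubsets σ) (from T-∧ (σ∈Δ , subsetEq-refl (image π σ)))

-- Linear algebra over a finite field

module Linear (F : FiniteField) where

  open FiniteField F renaming (refl to ≈-refl)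
  open Arrangement F
  open import Algebra.Properties.Ring ring using (-‿distribˡ-*; -‿distribʳ-*; -‿involutive; -0#≈0#; [y-z]x≈yx-zx)
  open import Algebra.Properties.Group +-group using (x∙y⁻¹≈ε⇒x≈y)
  open import Algebra.Properties.Semiring.Sum semiring
    using (sum; ∑-distrib-+; *-distribˡ-sum; *-distribʳ-sum; sum-remove; sum-permute)
  open SetoidReasoning setoid

  isZero⁻ : ∀ {x} → T (isZero x) → x ≈ 0#
  isZero⁻ {x} = does⁻ (x ≈? 0#)

  isZero⁺ : ∀ {x} → x ≈ 0# → T (isZero x)
  isZero⁺ {x} = does⁺ (x ≈? 0#)

  isZero-cong : ∀ {x y} → x ≈ y → isZero x ≡ isZero y
  isZero-cong x≈y = T-ext (λ t → isZero⁺ (trans (sym x≈y) (isZero⁻ t)))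
                          (λ t → isZero⁺ (trans x≈y (isZero⁻ t)))

  *-cancelˡ-≉0 : ∀ {x y} → ¬ x ≈ 0# → x * y ≈ 0# → y ≈ 0#
  *-cancelˡ-≉0 {x} {y} x≉0 xy≈0 with w , xw≈1 ← inverse x x≉0 = begin
    y             ≈⟨ *-identityˡ y ⟨
    1# * y        ≈⟨ *-congʳ (trans (*-comm w x) xw≈1) ⟨
    (w * x) * y   ≈⟨ *-assoc w x y ⟩
    w * (x * y)   ≈⟨ *-congˡ xy≈0 ⟩
    w * 0#        ≈⟨ zeroʳ w ⟩
    0#            ∎

  *-≉0 : ∀ {x y} → ¬ x ≈ 0# → ¬ y ≈ 0# → ¬ x * y ≈ 0#
  *-≉0 x≉0 y≉0 xy≈0 = y≉0 (*-cancelˡ-≉0 x≉0 xy≈0)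

  inverse-≉0 : ∀ {x w} → x * w ≈ 1# → ¬ w ≈ 0#
  inverse-≉0 {x} xw≈1 w≈0 = 1≉0 (trans (sym xw≈1) (trans (*-congˡ w≈0) (zeroʳ x)))

  -‿≉0 : ∀ {x} → ¬ x ≈ 0# → ¬ - x ≈ 0#
  -‿≉0 {x} x≉0 -x≈0 = x≉0 (begin
    x       ≈⟨ -‿involutive x ⟨
    - - x   ≈⟨ -‿cong -x≈0 ⟩
    - 0#    ≈⟨ -0#≈0# ⟩
    0#      ∎)

  *-swapˡ : ∀ x y z → x * (y * z) ≈ y * (x * z)
  *-swapˡ x y z = trans (sym (*-assoc x y z)) (trans (*-congʳ (*-comm x y)) (*-assoc y x z))

  divide-by-first : ∀ {f₁ f₂ x₁ x₂ w} → f₁ * w ≈ 1# → f₁ * x₁ + f₂ * x₂ ≈ 0# → x₁ + (f₂ * w) * x₂ ≈ 0#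
  divide-by-first {f₁} {f₂} {x₁} {x₂} {w} f₁w≈1 eq = begin
    x₁ + (f₂ * w) * x₂               ≈⟨ +-cong (*-identityˡ x₁) (*-congʳ (*-comm w f₂)) ⟨
    1# * x₁ + (w * f₂) * x₂           ≈⟨ +-congʳ (*-congʳ (trans (*-comm w f₁) f₁w≈1)) ⟨
    (w * f₁) * x₁ + (w * f₂) * x₂     ≈⟨ +-cong (*-assoc w f₁ x₁) (*-assoc w f₂ x₂) ⟩
    w * (f₁ * x₁) + w * (f₂ * x₂)     ≈⟨ distribˡ w _ _ ⟨
    w * (f₁ * x₁ + f₂ * x₂)           ≈⟨ *-congˡ eq ⟩
    w * 0#                            ≈⟨ zeroʳ w ⟩
    0#                                ∎

  distinct-lines-meet-at-0 : ∀ {a b x₁ x₂} → ¬ a ≈ b → x₁ + a * x₂ ≈ 0# → x₁ + b * x₂ ≈ 0# → x₁ ≈ 0#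
  distinct-lines-meet-at-0 {a} {b} {x₁} {x₂} a≉b eqa eqb = begin
    x₁               ≈⟨ +-identityʳ x₁ ⟨
    x₁ + 0#          ≈⟨ +-congˡ (trans (*-congˡ x₂≈0) (zeroʳ a)) ⟨
    x₁ + a * x₂      ≈⟨ eqa ⟩
    0#               ∎
    where
    a-b≉0 : ¬ (a - b) ≈ 0#
    a-b≉0 = a≉b ∘ x∙y⁻¹≈ε⇒x≈y a b
    x₂≈0 : x₂ ≈ 0#
    x₂≈0 = *-cancelˡ-≉0 a-b≉0 (begin
      (a - b) * x₂                          ≈⟨ [y-z]x≈yx-zx x₂ a b ⟩
      a * x₂ - b * x₂                       ≈⟨ +-cong (+-identityˡ _) (-‿cong (+-identityˡ _)) ⟨
      (0# + a * x₂) - (0# + b * x₂)         ≈⟨ +-cong (+-congʳ (-‿inverseˡ x₁)) (-‿cong (+-congʳ (-‿inverseˡ x₁))) ⟨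
      ((- x₁ + x₁) + a * x₂) - ((- x₁ + x₁) + b * x₂)
        ≈⟨ +-cong (+-assoc (- x₁) x₁ _) (-‿cong (+-assoc (- x₁) x₁ _)) ⟩
      (- x₁ + (x₁ + a * x₂)) - (- x₁ + (x₁ + b * x₂))
        ≈⟨ +-cong (+-congˡ eqa) (-‿cong (+-congˡ eqb)) ⟩
      (- x₁ + 0#) - (- x₁ + 0#)             ≈⟨ -‿inverseʳ _ ⟩
      0#                                    ∎)

  elems-cover : ∀ x → ∃ λ y → y ∈ elems × x ≈ y
  elems-cover x = find (complete x)

  _≈ᵛ_ : ∀ {n} → Vector n → Vector n → Set
  u ≈ᵛ v = ∀ i → u i ≈ v i

  allVecs-cover : ∀ {n} (v : Vector n) → ∃ λ v′ → v′ ∈ allVecs n × v ≈ᵛ v′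
  allVecs-cover {n} v = tuples-pointwise elems n _≈_ v (elems-cover ∘ v)

  sumF≡sum : ∀ {k} (f : Fin k → Carrier) → sumF f ≡ sum f
  sumF≡sum {zero}  f = ≡.refl
  sumF≡sum {suc k} f = cong (f Fin.zero +_) (sumF≡sum (f ∘ Fin.suc))

  sumF-cong : ∀ {k} {f g : Fin k → Carrier} → (∀ i → f i ≈ g i) → sumF f ≈ sumF g
  sumF-cong {zero}  h = ≈-refl
  sumF-cong {suc k} h = +-cong (h Fin.zero) (sumF-cong (h ∘ Fin.suc))

  sumF-zero : ∀ {k} (f : Fin k → Carrier) → (∀ i → f i ≈ 0#) → sumF f ≈ 0#
  sumF-zero {zero}  f h = ≈-refl
  sumF-zero {suc k} f h = trans (+-cong (h Fin.zero) (sumF-zero (f ∘ Fin.suc) (h ∘ Fin.suc))) (+-identityˡ 0#)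

  sumF-+ : ∀ {k} (f g : Fin k → Carrier) → sumF (λ i → f i + g i) ≈ sumF f + sumF g
  sumF-+ f g rewrite sumF≡sum (λ i → f i + g i) | sumF≡sum f | sumF≡sum g = ∑-distrib-+ f g

  sumF-*ˡ : ∀ {k} (s : Carrier) (f : Fin k → Carrier) → sumF (λ i → s * f i) ≈ s * sumF f
  sumF-*ˡ s f rewrite sumF≡sum (λ i → s * f i) | sumF≡sum f = sym (*-distribˡ-sum s f)

  sumF-*ʳ : ∀ {k} (s : Carrier) (f : Fin k → Carrier) → sumF (λ i → f i * s) ≈ sumF f * s
  sumF-*ʳ s f rewrite sumF≡sum (λ i → f i * s) | sumF≡sum f = sym (*-distribʳ-sum s f)

  sumF-remove : ∀ {k} (f : Fin (suc k) → Carrier) p → sumF f ≈ f p + sumF (f ∘ punchIn p)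
  sumF-remove f p rewrite sumF≡sum f | sumF≡sum (f ∘ punchIn p) = sum-remove {i = p} f

  sumF-permute : ∀ {k} (f : Fin k → Carrier) (σ : FinPerm.Permutation k k)
    → sumF f ≈ sumF (f ∘ (σ FinPerm.⟨$⟩ʳ_))
  sumF-permute f σ rewrite sumF≡sum f | sumF≡sum (f ∘ (σ FinPerm.⟨$⟩ʳ_)) = sum-permute f σ

  sumF-single : ∀ {k} (f : Fin k → Carrier) p → (∀ i → p ≢ i → f i ≈ 0#) → sumF f ≈ f p
  sumF-single {suc k} f p h = begin
    sumF f                      ≈⟨ sumF-remove f p ⟩
    f p + sumF (f ∘ punchIn p)  ≈⟨ +-congˡ (sumF-zero _ (λ i → h (punchIn p i) (Finₚ.punchInᵢ≢i p i ∘ ≡.sym))) ⟩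
    f p + 0#                    ≈⟨ +-identityʳ _ ⟩
    f p                         ∎

  dot-cong : ∀ {n} {a b x y : Vector n} → a ≈ᵛ b → x ≈ᵛ y → dot a x ≈ dot b y
  dot-cong a≈b x≈y = sumF-cong (λ i → *-cong (a≈b i) (x≈y i))

  unit : ∀ {k} → Fin k → Vector k
  unit p i = if does (p Fin.≟ i) then 1# else 0#

  unit-same : ∀ {k} (p : Fin k) → unit p p ≈ 1#
  unit-same p = reflexive (if-true (does⁺ (p Fin.≟ p) ≡.refl))

  unit-other : ∀ {k} {p i : Fin k} → p ≢ i → unit p i ≈ 0#
  unit-other {p = p} {i} p≢i = reflexive (if-false (T-not-elim (not-does⁺ (p Fin.≟ i) p≢i)))

  dot-unit : ∀ {k} (p : Fin k) (x : Vector k) → dot (unit p) x ≈ x p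
  dot-unit p x = begin
    sumF (λ i → unit p i * x i)  ≈⟨ sumF-single _ p (λ i p≢i → trans (*-congʳ (unit-other p≢i)) (zeroˡ _)) ⟩
    unit p p * x p               ≈⟨ trans (*-congʳ (unit-same p)) (*-identityˡ _) ⟩
    x p                          ∎

  dot-pair : ∀ {n} {p q : Fin (suc n)} (f x : Vector (suc n)) → p ≢ q → (∀ i → i ≢ p → i ≢ q → f i ≈ 0#)
    → dot f x ≈ f p * x p + f q * x q
  dot-pair {p = p} {q} f x p≢q f≈0 = begin
    dot f x
      ≈⟨ sumF-remove (λ i → f i * x i) p ⟩
    f p * x p + sumF (λ j → f (punchIn p j) * x (punchIn p j))
      ≈⟨ +-congˡ (sumF-single _ (punchOut p≢q) vanish) ⟩
    f p * x p + f (punchIn p (punchOut p≢q)) * x (punchIn p (punchOut p≢q))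
      ≡⟨ cong (λ i → f p * x p + f i * x i) (Finₚ.punchIn-punchOut p≢q) ⟩
    f p * x p + f q * x q ∎
    where
    vanish : ∀ j → punchOut p≢q ≢ j → f (punchIn p j) * x (punchIn p j) ≈ 0#
    vanish j q≢j = trans (*-congʳ (f≈0 (punchIn p j) (Finₚ.punchInᵢ≢i p j) (q≢j ∘ punchOut-≡))) (zeroˡ _)
      where
      punchOut-≡ : punchIn p j ≡ q → punchOut p≢q ≡ j
      punchOut-≡ eq = ≡.trans (Finₚ.punchOut-cong p (≡.sym eq)) (Finₚ.punchOut-punchIn p)

  nonzeroElems : List Carrier
  nonzeroElems = filter (λ x → ¬? (x ≈? 0#)) elems

  ∈-nonzeroElems⁻ : ∀ {b} → b ∈ nonzeroElems → ¬ b ≈ 0#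
  ∈-nonzeroElems⁻ b∈ = proj₂ (∈-filter⁻ (λ x → ¬? (x ≈? 0#)) {xs = elems} b∈)

  nonzeroElems-cover : ∀ {b} → ¬ b ≈ 0# → ∃ λ b′ → b′ ∈ nonzeroElems × b ≈ b′
  nonzeroElems-cover {b} b≉0 with b′ , b′∈ , b≈b′ ← elems-cover b =
    b′ , ∈-filter⁺ (λ x → ¬? (x ≈? 0#)) b′∈ (b≉0 ∘ trans b≈b′) , b≈b′

  nonzeroElems-distinct : AllPairs (λ x y → ¬ x ≈ y) nonzeroElems
  nonzeroElems-distinct = AllPairsₚ.filter⁺ (λ x → ¬? (x ≈? 0#)) distinct

  order≡1+|nonzeroElems| : order ≡ suc (length nonzeroElems)
  order≡1+|nonzeroElems| = count elems distinct (complete 0#)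
    where
    count : ∀ xs → AllPairs (λ x y → ¬ x ≈ y) xs → Any (0# ≈_) xs
      → length xs ≡ suc (length (filter (λ x → ¬? (x ≈? 0#)) xs))
    count (x ∷ xs) (x∉xs ∷ _) (here 0≈x) = cong suc (≡.sym (≡.trans
      (cong length (Listₚ.filter-reject (λ x → ¬? (x ≈? 0#)) {x = x} {xs = xs} (λ x≉0 → x≉0 (sym 0≈x))))
      (cong length (Listₚ.filter-all (λ x → ¬? (x ≈? 0#)) (All.map (λ x≉y y≈0 → x≉y (trans (sym 0≈x) (sym y≈0))) x∉xs)))))
    count (x ∷ xs) (x∉xs ∷ xs!) (there 0∈xs) = ≡.trans (cong suc (count xs xs! 0∈xs))
      (cong suc (≡.sym (cong length (Listₚ.filter-accept (λ x → ¬? (x ≈? 0#)) {x = x} {xs = xs} x≉0))))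
      where
      x≉0 : ¬ x ≈ 0#
      x≉0 x≈0 with y , y∈xs , 0≈y ← find 0∈xs = All.lookup x∉xs y∈xs (trans x≈0 0≈y)

  comb : ∀ {k n} → (Fin k → Carrier) → (Fin k → Vector n) → Vector n
  comb c vs j = sumF (λ i → c i * vs i j)

  comb-cong : ∀ {k n} {c c′ : Fin k → Carrier} {vs vs′ : Fin k → Vector n}
    → (∀ i → c i ≈ c′ i) → (∀ i → vs i ≈ᵛ vs′ i) → comb c vs ≈ᵛ comb c′ vs′
  comb-cong c≈c′ vs≈vs′ j = sumF-cong (λ i → *-cong (c≈c′ i) (vs≈vs′ i j))

  Independent : ∀ {k n} → (Fin k → Vector n) → Set
  Independent vs = ∀ c → (∀ j → comb c vs j ≈ 0#) → ∀ i → c i ≈ 0#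

  Dependent : ∀ {k n} → (Fin k → Vector n) → Set
  Dependent vs = ∃ λ c → (∃ λ i → ¬ c i ≈ 0#) × (∀ j → comb c vs j ≈ 0#)

  dependent⇒¬independent : ∀ {k n} {vs : Fin k → Vector n} → Dependent vs → ¬ Independent vs
  dependent⇒¬independent (c , (i , ci≉0) , c·vs≈0) ind = ci≉0 (ind c c·vs≈0 i)

  independent-resp : ∀ {k n} {vs vs′ : Fin k → Vector n} → (∀ i → vs i ≈ᵛ vs′ i) → Independent vs → Independent vs′
  independent-resp vs≈vs′ ind c c·vs′≈0 = ind c (λ j → trans (comb-cong (λ _ → ≈-refl) vs≈vs′ j) (c·vs′≈0 j))

  isZeroVec⁻ : ∀ {n} {v : Vector n} → T (isZeroVec v) → ∀ j → v j ≈ 0#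
  isZeroVec⁻ {n} {v} t j = isZero⁻ (allL⁻ (λ i → isZero (v i)) t (∈-allFin j))

  isZeroVec⁺ : ∀ {n} {v : Vector n} → (∀ j → v j ≈ 0#) → T (isZeroVec v)
  isZeroVec⁺ {n} {v} v≈0 = allL⁺ (λ i → isZero (v i)) (allFin n) (λ {j} _ → isZero⁺ (v≈0 j))

  independent⁻ : ∀ {k n} (vs : Fin k → Vector n) → T (independent vs) → Independent vs
  independent⁻ {k} vs t c c·vs≈0 i
    with c′ , c′∈ , c≈c′ ← tuples-pointwise elems k _≈_ c (elems-cover ∘ c)
    with to T-∨ (allL⁻ (λ c → not (isZeroVec (comb c vs)) ∨ allL (λ i → isZero (c i)) (allFin k)) t c′∈)
  ... | inj₁ c′·vs≉0 = ⊥-elim (T-not-elim c′·vs≉0 (isZeroVec⁺ (λ j → trans (comb-cong {vs = vs} (sym ∘ c≈c′) (λ _ _ → ≈-refl) j) (c·vs≈0 j))))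
  ... | inj₂ c′≈0    = trans (c≈c′ i) (isZero⁻ (allL⁻ (λ i → isZero (c′ i)) c′≈0 (∈-allFin i)))

  independent⁺ : ∀ {k n} (vs : Fin k → Vector n) → Independent vs → T (independent vs)
  independent⁺ {k} vs ind = allL⁺ _ (tuples elems k) (λ {c} _ → trivial-if-zero c (isZeroVec (comb c vs)) ≡.refl)
    where
    trivial-if-zero : ∀ c b → isZeroVec (comb c vs) ≡ b → T (not b ∨ allL (λ i → isZero (c i)) (allFin k))
    trivial-if-zero c false _ = tt
    trivial-if-zero c true  z = allL⁺ (λ i → isZero (c i)) (allFin k)
      (λ {i} _ → isZero⁺ (ind c (isZeroVec⁻ (subst T (≡.sym z) tt)) i))

  private
    coefficient-shift : ∀ c a r b → c * a + (- (c * r)) * b ≈ c * (a - r * b)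
    coefficient-shift c a r b = begin
      c * a + (- (c * r)) * b  ≈⟨ +-congˡ (-‿distribˡ-* (c * r) b) ⟨
      c * a + - ((c * r) * b)  ≈⟨ +-congˡ (-‿cong (*-assoc c r b)) ⟩
      c * a + - (c * (r * b))  ≈⟨ +-congˡ (-‿distribʳ-* c (r * b)) ⟩
      c * a + c * (- (r * b))  ≈⟨ distribˡ c a _ ⟨
      c * (a - r * b)          ∎

  dependent-eliminate : ∀ {k n} (vs : Fin (suc k) → Vector n) (p : Fin (suc k)) (r : Fin k → Carrier)
    → Dependent (λ i j → vs (punchIn p i) j - r i * vs p j) → Dependent vs
  dependent-eliminate vs p r (c′ , (i , c′i≉0) , c′·w≈0) =
    c , (punchIn p i , c′i≉0 ∘ trans (reflexive (≡.sym (VFₚ.insertAt-punchIn c′ p s i)))) , λ j → trans (c·vs≈c′·w j) (c′·w≈0 j)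
    where
    s = sumF (λ i → - (c′ i * r i))
    c = VF.insertAt c′ p s
    c·vs≈c′·w : ∀ j → comb c vs j ≈ comb c′ (λ i j → vs (punchIn p i) j - r i * vs p j) j
    c·vs≈c′·w j = begin
      comb c vs j
        ≈⟨ sumF-remove (λ i → c i * vs i j) p ⟩
      c p * vs p j + sumF (λ i → c (punchIn p i) * vs (punchIn p i) j)
        ≈⟨ +-cong (*-congʳ (reflexive (VFₚ.insertAt-lookup c′ p s)))
                  (sumF-cong (λ i → *-congʳ (reflexive (VFₚ.insertAt-punchIn c′ p s i)))) ⟩
      s * vs p j + sumF (λ i → c′ i * vs (punchIn p i) j)
        ≈⟨ +-comm _ _ ⟩
      sumF (λ i → c′ i * vs (punchIn p i) j) + s * vs p j
        ≈⟨ +-congˡ (sumF-*ʳ (vs p j) (λ i → - (c′ i * r i))) ⟨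
      sumF (λ i → c′ i * vs (punchIn p i) j) + sumF (λ i → - (c′ i * r i) * vs p j)
        ≈⟨ sumF-+ (λ i → c′ i * vs (punchIn p i) j) (λ i → - (c′ i * r i) * vs p j) ⟨
      sumF (λ i → c′ i * vs (punchIn p i) j + - (c′ i * r i) * vs p j)
        ≈⟨ sumF-cong (λ i → coefficient-shift (c′ i) (vs (punchIn p i) j) (r i) (vs p j)) ⟩
      comb c′ (λ i j → vs (punchIn p i) j - r i * vs p j) j ∎

  dependent-tail : ∀ {k n} (vs : Fin k → Vector (suc n)) → (∀ i → vs i Fin.zero ≈ 0#)
    → Dependent (λ i → vs i ∘ Fin.suc) → Dependent vs
  dependent-tail vs heads≈0 (c , nontrivial , c·tails≈0) = c , nontrivial , λ
    { Fin.zero    → sumF-zero _ (λ i → trans (*-congˡ (heads≈0 i)) (zeroʳ _))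
    ; (Fin.suc j) → c·tails≈0 j
    }

  -- Gaussian elimination on the first coordinate
  dependent-if-more-vectors : ∀ {n k} → n ℕ.< k → (vs : Fin k → Vector n) → Dependent vs
  dependent-if-more-vectors {zero}  {suc k} _ vs = (λ _ → 1#) , (Fin.zero , 1≉0) , λ ()
  dependent-if-more-vectors {suc n} {suc k} (ℕ.s≤s n<k) vs with Finₚ.all? (λ i → vs i Fin.zero ≈? 0#)
  ... | yes heads≈0 = dependent-tail vs heads≈0 (dependent-if-more-vectors (ℕₚ.m<n⇒m<1+n n<k) (λ i → vs i ∘ Fin.suc))
  ... | no ¬heads≈0 = pivot (Finₚ.¬∀⟶∃¬ (suc k) _ (λ i → vs i Fin.zero ≈? 0#) ¬heads≈0)
    where
    pivot : (∃ λ p → ¬ vs p Fin.zero ≈ 0#) → Dependent vs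
    pivot (p , vp≉0) with u , vpu≈1 ← inverse (vs p Fin.zero) vp≉0 =
      dependent-eliminate vs p r (dependent-tail _ reduced-heads≈0 (dependent-if-more-vectors n<k _))
      where
      r : Fin k → Carrier
      r i = vs (punchIn p i) Fin.zero * u
      reduced-heads≈0 : ∀ i → vs (punchIn p i) Fin.zero - r i * vs p Fin.zero ≈ 0#
      reduced-heads≈0 i = let a = vs (punchIn p i) Fin.zero ; b = vs p Fin.zero in begin
        a - (a * u) * b  ≈⟨ +-congˡ (-‿cong (trans (*-assoc a u b) (*-congˡ (*-comm u b)))) ⟩
        a - a * (b * u)  ≈⟨ +-congˡ (-‿cong (trans (*-congˡ vpu≈1) (*-identityʳ a))) ⟩
        a - a            ≈⟨ -‿inverseʳ a ⟩
        0#               ∎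

  Respects≈ : ∀ {n} → (Vector n → Bool) → Set
  Respects≈ W = ∀ {x y} → x ≈ᵛ y → W x ≡ W y

  hasIndependentFamily : ∀ {n} → (Vector n → Bool) → ℕ → Bool
  hasIndependentFamily {n} W k =
    anyL (λ vs → allL (λ i → W (vs i)) (allFin k) ∧ independent vs) (tuples (allVecs n) k)

  hasIndependentFamily⁻ : ∀ {n} (W : Vector n → Bool) k → T (hasIndependentFamily W k)
    → ∃ λ vs → (∀ i → T (W (vs i))) × Independent vs
  hasIndependentFamily⁻ {n} W k t
    with vs , _ , t′ ← anyL⁻ _ (tuples (allVecs n) k) t
    with vs∈W , ind ← to T-∧ t′
    = vs , (λ i → allL⁻ (W ∘ vs) vs∈W (∈-allFin i)) , independent⁻ vs ind

  hasIndependentFamily⁺ : ∀ {n} (W : Vector n → Bool) k → Respects≈ W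
    → (vs : Fin k → Vector n) → (∀ i → T (W (vs i))) → Independent vs → T (hasIndependentFamily W k)
  hasIndependentFamily⁺ {n} W k W-resp vs vs∈W ind
    with vs′ , vs′∈ , vs≈vs′ ← tuples-pointwise (allVecs n) k _≈ᵛ_ vs (allVecs-cover ∘ vs)
    = anyL⁺ (λ vs → allL (λ i → W (vs i)) (allFin k) ∧ independent vs) vs′∈
        (from T-∧ ( allL⁺ (W ∘ vs′) (allFin k) (λ {i} _ → subst T (W-resp (vs≈vs′ i)) (vs∈W i))
                  , independent⁺ vs′ (independent-resp vs≈vs′ ind)))

  Agree : ∀ {n} → (Vector n → Bool) → (Vector n → Bool) → Set
  Agree {n} W W′ = ∀ {x} → x ∈ allVecs n → W x ≡ W′ x

  dim-cong : ∀ {n} (W W′ : Vector n → Bool) → Agree W W′ → dim W ≡ dim W′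
  dim-cong {n} W W′ W≡W′ =
    cong (foldr _⊔_ 0) (Listₚ.map-cong (λ k → cong (λ b → if b then k else 0) (same-families k)) (upTo (suc n)))
    where
    same-families : ∀ k → hasIndependentFamily W k ≡ hasIndependentFamily W′ k
    same-families k = anyL-cong (tuples (allVecs n) k) λ {vs} vs∈ →
      cong (_∧ independent vs) (allL-cong (allFin k) (λ {i} _ → W≡W′ (∈-tuples⁻ (allVecs n) k vs∈ i)))

  IsLinear : ∀ {m n} → (Vector m → Vector n) → Set
  IsLinear f = ∀ {k} (c : Fin k → Carrier) vs → f (comb c vs) ≈ᵛ comb c (f ∘ vs)

  Congruent : ∀ {m n} → (Vector m → Vector n) → Set
  Congruent f = ∀ {u v} → u ≈ᵛ v → f u ≈ᵛ f v

  independent-preimage : ∀ {k m n} {f : Vector m → Vector n} → Congruent f → IsLinear f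
    → (vs : Fin k → Vector m) → Independent (f ∘ vs) → Independent vs
  independent-preimage {f = f} f-cong f-lin vs ind c c·vs≈0 = ind c λ j → begin
    comb c (f ∘ vs) j             ≈⟨ f-lin c vs j ⟨
    f (comb c vs) j               ≈⟨ f-cong c·vs≈0 j ⟩
    f (comb {0} (λ ()) (λ ())) j  ≈⟨ f-lin {0} (λ ()) (λ ()) j ⟩
    0#                            ∎

  module _ {m} (V : Vector (suc m) → Bool) (V-resp : Respects≈ V)
           {ψ : Vector m → Vector (suc m)} {ρ : Vector (suc m) → Vector m}
           (ψ-cong : Congruent ψ) (ρ-cong : Congruent ρ) (ψ-lin : IsLinear ψ) (ρ-lin : IsLinear ρ)
           (ρψ≈id : ∀ y → ρ (ψ y) ≈ᵛ y) (ψρ≈id : ∀ x → T (V x) → ψ (ρ x) ≈ᵛ x) where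

    hasIndependentFamily-transport : ∀ k → hasIndependentFamily V k ≡ hasIndependentFamily (V ∘ ψ) k
    hasIndependentFamily-transport k = T-ext pull push
      where
      pull : T (hasIndependentFamily V k) → T (hasIndependentFamily (V ∘ ψ) k)
      pull t with us , us∈V , ind ← hasIndependentFamily⁻ V k t =
        hasIndependentFamily⁺ (V ∘ ψ) k (V-resp ∘ ψ-cong) (ρ ∘ us)
          (λ i → subst T (≡.sym (V-resp (ψρ≈id (us i) (us∈V i)))) (us∈V i))
          (independent-preimage ψ-cong ψ-lin (ρ ∘ us)
            (independent-resp (λ i j → sym (ψρ≈id (us i) (us∈V i) j)) ind))
      push : T (hasIndependentFamily (V ∘ ψ) k) → T (hasIndependentFamily V k)
      push t with vs , vs∈Vψ , ind ← hasIndependentFamily⁻ (V ∘ ψ) k t =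
        hasIndependentFamily⁺ V k V-resp (ψ ∘ vs) vs∈Vψ
          (independent-preimage ρ-cong ρ-lin (ψ ∘ vs) (independent-resp (λ i j → sym (ρψ≈id (vs i) j)) ind))

    -- dim V also ranges over family size m + 1, but m + 1 vectors of V ≅ F^m are dependent
    dim-transport : dim V ≡ dim (V ∘ ψ)
    dim-transport = ≡.trans (⊔-upTo-dropLast g (suc m) no-family-of-size-m+1)
      (cong (foldr _⊔_ 0) (Listₚ.map-cong (λ k → cong (λ b → if b then k else 0) (hasIndependentFamily-transport k)) (upTo (suc m))))
      where
      g : ℕ → ℕ
      g k = if hasIndependentFamily V k then k else 0
      no-family-of-size-m+1 : g (suc m) ≡ 0
      no-family-of-size-m+1 rewrite hasIndependentFamily-transport (suc m)
        with hasIndependentFamily (V ∘ ψ) (suc m) in eq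
      ... | false = ≡.refl
      ... | true with vs , _ , ind ← hasIndependentFamily⁻ (V ∘ ψ) (suc m) (subst T (≡.sym eq) tt)
        = ⊥-elim (dependent⇒¬independent {vs = vs} (dependent-if-more-vectors ℕₚ.≤-refl vs) ind)

-- Characteristic coefficients of an arrangement restricted to a subspace

module RestrictedChi (F : FiniteField) where

  open FiniteField F renaming (refl to ≈-refl)
  open Arrangement F
  open Linear F

  sumℤ : List ℤ.ℤ → ℤ.ℤ
  sumℤ = foldr ℤ._+_ ℤ.0ℤ

  sumℤ-++ : ∀ xs ys → sumℤ (xs ++ ys) ≡ sumℤ xs ℤ.+ sumℤ ys
  sumℤ-++ []       ys = ≡.sym (ℤₚ.+-identityˡ _)
  sumℤ-++ (x ∷ xs) ys = ≡.trans (cong (λ y → x ℤ.+ y) (sumℤ-++ xs ys)) (≡.sym (ℤₚ.+-assoc x _ _))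

  sumℤ-neg : ∀ xs → sumℤ (map ℤ.-_ xs) ≡ ℤ.- sumℤ xs
  sumℤ-neg []       = ≡.refl
  sumℤ-neg (x ∷ xs) = ≡.trans (cong (λ y → ℤ.- x ℤ.+ y) (sumℤ-neg xs)) (≡.sym (ℤₚ.neg-distrib-+ x _))

  sumℤ-const : {A : Set} (f : A → ℤ.ℤ) (v : ℤ.ℤ) (xs : List A) → (∀ {x} → x ∈ xs → f x ≡ v)
    → sumℤ (map f xs) ≡ ℤ.+ length xs ℤ.* v
  sumℤ-const f v []       _ = ≡.sym (ℤₚ.*-zeroˡ v)
  sumℤ-const f v (x ∷ xs) h = ≡.trans (cong₂ ℤ._+_ (h (here ≡.refl)) (sumℤ-const f v xs (h ∘ there)))
    (≡.sym (≡.trans (ℤₚ.*-distribʳ-+ v (ℤ.+ 1) (ℤ.+ length xs)) (cong (λ y → y ℤ.+ ℤ.+ length xs ℤ.* v) (ℤₚ.*-identityˡ v))))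

  _∩ker_ : ∀ {n} → (Vector n → Bool) → Vector n → (Vector n → Bool)
  (W ∩ker a) x = W x ∧ isZero (dot a x)

  term : ∀ {n} → (Vector n → Bool) → ℕ → List (Vector n) → ℤ.ℤ
  term W d B = if does (dim (λ x → W x ∧ inIntersection B x) ℕ.≟ d) then sign (length B) else ℤ.0ℤ

  chiOn : ∀ {n} → List (Vector n) → (Vector n → Bool) → ℕ → ℤ.ℤ
  chiOn L W d = sumℤ (map (term W d) (sublists L))

  chiCoeff≡chiOn : ∀ {n} (face : Subset n → Bool) d → chiCoeff face d ≡ chiOn (arrangement face) (λ _ → true) d
  chiCoeff≡chiOn face d = ≡.refl

  chiOn-cong : ∀ {n} (L : List (Vector n)) {W W′ : Vector n → Bool} d → Agree W W′ → chiOn L W d ≡ chiOn L W′ d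
  chiOn-cong L d W≡W′ = cong sumℤ (Listₚ.map-cong (λ B →
    cong (λ m → if does (m ℕ.≟ d) then sign (length B) else ℤ.0ℤ)
         (dim-cong _ _ (λ {x} x∈ → cong (_∧ inIntersection B x) (W≡W′ x∈)))) (sublists L))

  term-∷ : ∀ {n} (W : Vector n → Bool) d a (B : List (Vector n)) → term W d (a ∷ B) ≡ ℤ.- term (W ∩ker a) d B
  term-∷ W d a B
    rewrite dim-cong (λ x → W x ∧ (isZero (dot a x) ∧ inIntersection B x))
                     (λ x → (W ∩ker a) x ∧ inIntersection B x)
                     (λ {x} _ → ≡.sym (∧-assoc (W x) _ _))
    with does (dim (λ x → (W ∩ker a) x ∧ inIntersection B x) ℕ.≟ d)
  ... | true  = ≡.refl
  ... | false = ≡.refl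

  chiOn-∷ : ∀ {n} a (L : List (Vector n)) W d → chiOn (a ∷ L) W d ≡ chiOn L W d ℤ.- chiOn L (W ∩ker a) d
  chiOn-∷ a L W d = begin
    sumℤ (map (term W d) (sublists L ++ map (a ∷_) (sublists L)))
      ≡⟨ cong sumℤ (Listₚ.map-++ (term W d) (sublists L) _) ⟩
    sumℤ (map (term W d) (sublists L) ++ map (term W d) (map (a ∷_) (sublists L)))
      ≡⟨ sumℤ-++ (map (term W d) (sublists L)) _ ⟩
    chiOn L W d ℤ.+ sumℤ (map (term W d) (map (a ∷_) (sublists L)))
      ≡⟨ cong (λ xs → chiOn L W d ℤ.+ sumℤ xs) (≡.sym (Listₚ.map-∘ (sublists L))) ⟩
    chiOn L W d ℤ.+ sumℤ (map (term W d ∘ (a ∷_)) (sublists L))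
      ≡⟨ cong (λ xs → chiOn L W d ℤ.+ sumℤ xs) (Listₚ.map-cong (term-∷ W d a) (sublists L)) ⟩
    chiOn L W d ℤ.+ sumℤ (map (ℤ.-_ ∘ term (W ∩ker a) d) (sublists L))
      ≡⟨ cong (λ xs → chiOn L W d ℤ.+ sumℤ xs) (Listₚ.map-∘ (sublists L)) ⟩
    chiOn L W d ℤ.+ sumℤ (map ℤ.-_ (map (term (W ∩ker a) d) (sublists L)))
      ≡⟨ cong (λ y → chiOn L W d ℤ.+ y) (sumℤ-neg (map (term (W ∩ker a) d) (sublists L))) ⟩
    chiOn L W d ℤ.- chiOn L (W ∩ker a) d ∎
    where open ≡.≡-Reasoning

  _⊆ker_ : ∀ {n} → (Vector n → Bool) → Vector n → Set
  _⊆ker_ {n} W b = ∀ {x} → x ∈ allVecs n → T (W x) → T (isZero (dot b x))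

  ker_⊆ker_on_ : ∀ {n} → Vector n → Vector n → (Vector n → Bool) → Set
  ker a ⊆ker b on W = (W ∩ker a) ⊆ker b

  ⊆ker⇒Agree : ∀ {n} {W : Vector n → Bool} {b} → W ⊆ker b → Agree W (W ∩ker b)
  ⊆ker⇒Agree {W = W} W⊆b {x} x∈ with W x in eq
  ... | false = ≡.refl
  ... | true  = ≡.sym (to T-≡ (W⊆b x∈ (subst T (≡.sym eq) tt)))

  chiOn-vanish : ∀ {n} (L : List (Vector n)) W d {b} → b ∈ L → W ⊆ker b → chiOn L W d ≡ ℤ.0ℤ
  chiOn-vanish (c ∷ L) W d (here ≡.refl) W⊆c = begin
    chiOn (c ∷ L) W d                        ≡⟨ chiOn-∷ c L W d ⟩
    chiOn L W d ℤ.- chiOn L (W ∩ker c) d     ≡⟨ cong (λ y → chiOn L W d ℤ.- y) (chiOn-cong L d (⊆ker⇒Agree W⊆c)) ⟨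
    chiOn L W d ℤ.- chiOn L W d              ≡⟨ ℤₚ.+-inverseʳ (chiOn L W d) ⟩
    ℤ.0ℤ                                     ∎
    where open ≡.≡-Reasoning
  chiOn-vanish (c ∷ L) W d (there b∈L) W⊆b = begin
    chiOn (c ∷ L) W d                        ≡⟨ chiOn-∷ c L W d ⟩
    chiOn L W d ℤ.- chiOn L (W ∩ker c) d     ≡⟨ cong₂ ℤ._-_ (chiOn-vanish L W d b∈L W⊆b)
                                                 (chiOn-vanish L (W ∩ker c) d b∈L (λ x∈ → W⊆b x∈ ∘ proj₁ ∘ to T-∧)) ⟩
    ℤ.0ℤ                                     ∎
    where open ≡.≡-Reasoning

  chiOn-absorb : ∀ {n} a {b} (L : List (Vector n)) W d → b ∈ L → ker a ⊆ker b on W → chiOn (a ∷ L) W d ≡ chiOn L W d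
  chiOn-absorb a L W d b∈L a⊆b = begin
    chiOn (a ∷ L) W d                       ≡⟨ chiOn-∷ a L W d ⟩
    chiOn L W d ℤ.- chiOn L (W ∩ker a) d    ≡⟨ cong (λ y → chiOn L W d ℤ.- y) (chiOn-vanish L (W ∩ker a) d b∈L a⊆b) ⟩
    chiOn L W d ℤ.- ℤ.0ℤ                    ≡⟨ ℤₚ.+-identityʳ (chiOn L W d) ⟩
    chiOn L W d                             ∎
    where open ≡.≡-Reasoning

  private
    chiOn-prep : ∀ {n} x {xs ys : List (Vector n)} d → (∀ W → chiOn xs W d ≡ chiOn ys W d)
      → ∀ W → chiOn (x ∷ xs) W d ≡ chiOn (x ∷ ys) W d
    chiOn-prep x {xs} {ys} d xs≡ys W = begin
      chiOn (x ∷ xs) W d                         ≡⟨ chiOn-∷ x xs W d ⟩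
      chiOn xs W d ℤ.- chiOn xs (W ∩ker x) d     ≡⟨ cong₂ ℤ._-_ (xs≡ys W) (xs≡ys (W ∩ker x)) ⟩
      chiOn ys W d ℤ.- chiOn ys (W ∩ker x) d     ≡⟨ chiOn-∷ x ys W d ⟨
      chiOn (x ∷ ys) W d                         ∎
      where open ≡.≡-Reasoning

    ∩ker-comm : ∀ {n} (W : Vector n → Bool) a b → Agree ((W ∩ker a) ∩ker b) ((W ∩ker b) ∩ker a)
    ∩ker-comm W a b {x} _ = begin
      (W x ∧ isZero (dot a x)) ∧ isZero (dot b x)  ≡⟨ ∧-assoc (W x) _ _ ⟩
      W x ∧ (isZero (dot a x) ∧ isZero (dot b x))  ≡⟨ cong (W x ∧_) (∧-comm (isZero (dot a x)) _) ⟩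
      W x ∧ (isZero (dot b x) ∧ isZero (dot a x))  ≡⟨ ∧-assoc (W x) _ _ ⟨
      (W x ∧ isZero (dot b x)) ∧ isZero (dot a x)  ∎
      where open ≡.≡-Reasoning

    chiOn-swap : ∀ {n} a b (L : List (Vector n)) W d → chiOn (a ∷ b ∷ L) W d ≡ chiOn (b ∷ a ∷ L) W d
    chiOn-swap a b L W d = begin
      chiOn (a ∷ b ∷ L) W d
        ≡⟨ chiOn-∷ a (b ∷ L) W d ⟩
      chiOn (b ∷ L) W d ℤ.- chiOn (b ∷ L) (W ∩ker a) d
        ≡⟨ cong₂ ℤ._-_ (chiOn-∷ b L W d) (chiOn-∷ b L (W ∩ker a) d) ⟩
      (X W ℤ.- X (W ∩ker b)) ℤ.- (X (W ∩ker a) ℤ.- X ((W ∩ker a) ∩ker b))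
        ≡⟨ cong (λ y → (X W ℤ.- X (W ∩ker b)) ℤ.- (X (W ∩ker a) ℤ.- y)) (chiOn-cong L d (∩ker-comm W a b)) ⟩
      (X W ℤ.- X (W ∩ker b)) ℤ.- (X (W ∩ker a) ℤ.- X ((W ∩ker b) ∩ker a))
        ≡⟨ solve 4 (λ p q r s → (p :- q) :- (r :- s) := (p :- r) :- (q :- s)) ≡.refl
                   (X W) (X (W ∩ker b)) (X (W ∩ker a)) (X ((W ∩ker b) ∩ker a)) ⟩
      (X W ℤ.- X (W ∩ker a)) ℤ.- (X (W ∩ker b) ℤ.- X ((W ∩ker b) ∩ker a))
        ≡⟨ cong₂ ℤ._-_ (chiOn-∷ a L W d) (chiOn-∷ a L (W ∩ker b) d) ⟨
      chiOn (a ∷ L) W d ℤ.- chiOn (a ∷ L) (W ∩ker b) d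
        ≡⟨ chiOn-∷ b (a ∷ L) W d ⟨
      chiOn (b ∷ a ∷ L) W d ∎
      where
      open ≡.≡-Reasoning
      open +-*-Solver using (solve; _:=_; _:-_)
      X = λ W → chiOn L W d

  chiOn-↭ : ∀ {n} {L L′ : List (Vector n)} → L ↭ L′ → ∀ W d → chiOn L W d ≡ chiOn L′ W d
  chiOn-↭ ↭.refl                   W d = ≡.refl
  chiOn-↭ (↭.prep {xs} {ys} x p)   W d = chiOn-prep x {xs} {ys} d (λ W′ → chiOn-↭ p W′ d) W
  chiOn-↭ (↭.swap {xs} {ys} x y p) W d =
    ≡.trans (chiOn-swap x y xs W d)
            (chiOn-prep y {x ∷ xs} {x ∷ ys} d (chiOn-prep x {xs} {ys} d (λ W′ → chiOn-↭ p W′ d)) W)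
  chiOn-↭ (↭.trans p q)            W d = ≡.trans (chiOn-↭ p W d) (chiOn-↭ q W d)

  _≼_on_ : ∀ {n} → List (Vector n) → List (Vector n) → (Vector n → Bool) → Set
  _≼_on_ {n} L M W = ∀ {a} → a ∈ L → ∃ λ b → b ∈ M × ker a ⊆ker b on W

  chiOn-absorb-++ : ∀ {n} (M L : List (Vector n)) W d → M ≼ L on W → chiOn (M ++ L) W d ≡ chiOn L W d
  chiOn-absorb-++ []      L W d _   = ≡.refl
  chiOn-absorb-++ (a ∷ M) L W d M≼L with b , b∈L , a⊆b ← M≼L (here ≡.refl) =
    ≡.trans (chiOn-absorb a (M ++ L) W d (∈-++⁺ʳ M b∈L) a⊆b) (chiOn-absorb-++ M L W d (M≼L ∘ there))

  chiOn-cover : ∀ {n} (L M : List (Vector n)) W d → L ≼ M on W → M ≼ L on W → chiOn L W d ≡ chiOn M W d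
  chiOn-cover L M W d L≼M M≼L = begin
    chiOn L W d         ≡⟨ chiOn-absorb-++ M L W d M≼L ⟨
    chiOn (M ++ L) W d  ≡⟨ chiOn-↭ (↭ₚ.++-comm M L) W d ⟩
    chiOn (L ++ M) W d  ≡⟨ chiOn-absorb-++ L M W d L≼M ⟩
    chiOn M W d         ∎
    where open ≡.≡-Reasoning

  ⊆ker-refl : ∀ {n} (a : Vector n) W → ker a ⊆ker a on W
  ⊆ker-refl a W _ t = proj₂ (to T-∧ t)

  SameKernel : ∀ {n} → Vector n → Vector n → Set
  SameKernel {n} a b = ∀ {x} → x ∈ allVecs n → isZero (dot a x) ≡ isZero (dot b x)

  sameKernel-sound : ∀ {n} (a b : Vector n) → T (sameKernel a b) → SameKernel a b
  sameKernel-sound {n} a b t {x} x∈ =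
    does⁻ (isZero (dot a x) ≟ᵇ isZero (dot b x)) (allL⁻ (λ x → does (isZero (dot a x) ≟ᵇ isZero (dot b x))) t x∈)

  SameKernel⇒⊆ker : ∀ {n} {a b : Vector n} {W} → SameKernel a b → ker a ⊆ker b on W
  SameKernel⇒⊆ker a≡b x∈ t = subst T (a≡b x∈) (proj₂ (to T-∧ t))

  ∈-deduplicate-upToKernel : ∀ {n} (L : List (Vector n)) {a} → a ∈ L
    → ∃ λ b → b ∈ deduplicateᵇ sameKernel L × SameKernel b a
  ∈-deduplicate-upToKernel (c ∷ L) (here ≡.refl) = c , here ≡.refl , λ _ → ≡.refl
  ∈-deduplicate-upToKernel (c ∷ L) (there a∈L)
    with b , b∈ , b≡a ← ∈-deduplicate-upToKernel L a∈L
    with T? (sameKernel c b)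
  ... | yes c≡b = c , here ≡.refl , λ x∈ → ≡.trans (sameKernel-sound c b c≡b x∈) (b≡a x∈)
  ... | no  c≢b = b , there (∈-filter⁺ (λ b → ¬? (T? (sameKernel c b))) b∈ c≢b) , b≡a

  chiOn-deduplicate : ∀ {n} (L : List (Vector n)) W d → chiOn (deduplicateᵇ sameKernel L) W d ≡ chiOn L W d
  chiOn-deduplicate L W d = chiOn-cover (deduplicateᵇ sameKernel L) L W d
    (λ {a} a∈ → a , ∈-deduplicate⁻ (λ a b → T? (sameKernel a b)) L a∈ , ⊆ker-refl a W)
    (λ a∈ → let b , b∈ , b≡a = ∈-deduplicate-upToKernel L a∈ in b , b∈ , SameKernel⇒⊆ker {W = W} (≡.sym ∘ b≡a))

module Forms (F : FiniteField) where

  open FiniteField F renaming (refl to ≈-refl)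
  open Arrangement F
  open Linear F

  SupportedAt : ∀ {n} → Subset n → Vector n → Fin n → Set
  SupportedAt σ a i = (T (lookup σ i) → ¬ a i ≈ 0#) × (¬ T (lookup σ i) → a i ≈ 0#)

  SupportedOn : ∀ {n} → Subset n → Vector n → Set
  SupportedOn σ a = ∀ i → SupportedAt σ a i

  supportedExactlyOn⁻ : ∀ {n} (σ : Subset n) a → T (supportedExactlyOn σ a) → SupportedOn σ a
  supportedExactlyOn⁻ σ a t i = entry (lookup σ i) (allL⁻ (λ i → if lookup σ i then not (isZero (a i)) else isZero (a i)) t (∈-allFin i))
    where
    entry : ∀ b → T (if b then not (isZero (a i)) else isZero (a i)) → (T b → ¬ a i ≈ 0#) × (¬ T b → a i ≈ 0#)
    entry true  t = (λ _ → T-not-elim t ∘ isZero⁺) , (λ ¬b → ⊥-elim (¬b tt))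
    entry false t = (λ ()) , (λ _ → isZero⁻ t)

  supportedExactlyOn⁺ : ∀ {n} (σ : Subset n) a → SupportedOn σ a → T (supportedExactlyOn σ a)
  supportedExactlyOn⁺ {n} σ a supp = allL⁺ _ (allFin n) (λ {i} _ → entry (lookup σ i) (proj₁ (supp i)) (proj₂ (supp i)))
    where
    entry : ∀ {i} b → (T b → ¬ a i ≈ 0#) → (¬ T b → a i ≈ 0#) → T (if b then not (isZero (a i)) else isZero (a i))
    entry {i} true  ≉0 _ = not-does⁺ (a i ≈? 0#) (≉0 tt)
    entry     false _ ≈0 = isZero⁺ (≈0 λ ())

  SupportedOn-resp : ∀ {n} (σ : Subset n) {a b} → a ≈ᵛ b → SupportedOn σ a → SupportedOn σ b
  SupportedOn-resp σ a≈b supp i = (λ t → proj₁ (supp i) t ∘ trans (a≈b i)) , (trans (sym (a≈b i)) ∘ proj₂ (supp i))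

  unit-supported : ∀ {n} (p : Fin n) → SupportedOn ⁅ p ⁆ (unit p)
  unit-supported p i =
      (λ i∈ → 1≉0 ∘ trans (sym (subst (λ j → unit p j ≈ 1#) (≡.sym (T-lookup-⁅⁆ i∈)) (unit-same p))))
    , (λ i∉ → unit-other (i∉ ∘ λ p≡i → subst (T ∘ lookup ⁅ p ⁆) p≡i (T-lookup-⁅self⁆ p)))

  private
    formsOn : ∀ {n} → (Subset n → Bool) → Subset n → List (Vector n)
    formsOn {n} face σ = if face σ ∧ isNonempty σ then filter (λ a → T? (supportedExactlyOn σ a)) (allVecs n) else []

    ∈-if⁻ : {A : Set} (b : Bool) {l : List A} {a : A} → a ∈ (if b then l else []) → T b × a ∈ l
    ∈-if⁻ true a∈ = tt , a∈

    ∈-if⁺ : {A : Set} {b : Bool} {l : List A} {a : A} → T b → a ∈ l → a ∈ (if b then l else [])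
    ∈-if⁺ {b = true} _ a∈ = a∈

  ∈-forms⁻ : ∀ {n} (face : Subset n → Bool) {a} → a ∈ forms face
    → ∃ λ σ → T (face σ) × T (isNonempty σ) × a ∈ allVecs n × SupportedOn σ a
  ∈-forms⁻ {n} face {a} a∈
    with σ , _ , a∈σ ← find (∈-concatMap⁻ (formsOn face) {xs = allSubsets n} a∈)
    with σ∈Δ , a∈′ ← ∈-if⁻ (face σ ∧ isNonempty σ) a∈σ
    with a∈all , supp ← ∈-filter⁻ (λ a → T? (supportedExactlyOn σ a)) {xs = allVecs n} a∈′
    = σ , proj₁ (to T-∧ σ∈Δ) , proj₂ (to T-∧ σ∈Δ) , a∈all , supportedExactlyOn⁻ σ a supp

  ∈-forms⁺ : ∀ {n} (face : Subset n → Bool) {σ a} → T (face σ) → T (isNonempty σ)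
    → a ∈ allVecs n → SupportedOn σ a → a ∈ forms face
  ∈-forms⁺ {n} face {σ} {a} σ∈Δ σ≢∅ a∈all supp = ∈-concatMap⁺ (formsOn face) {xs = allSubsets n}
    (lose (∈-allSubsets σ) (∈-if⁺ (from T-∧ (σ∈Δ , σ≢∅))
      (∈-filter⁺ (λ a → T? (supportedExactlyOn σ a)) a∈all (supportedExactlyOn⁺ σ a supp))))

  forms-cover : ∀ {n} (face : Subset n → Bool) {σ a} → T (face σ) → T (isNonempty σ)
    → SupportedOn σ a → ∃ λ a′ → a′ ∈ forms face × a ≈ᵛ a′
  forms-cover face {σ} {a} σ∈Δ σ≢∅ supp with a′ , a′∈ , a≈a′ ← allVecs-cover a =
    a′ , ∈-forms⁺ face σ∈Δ σ≢∅ a′∈ (SupportedOn-resp σ a≈a′ supp) , a≈a′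

module Identification {m : ℕ} {i₁ i₂ : Fin (suc m)} (i₁≢i₂ : i₁ ≢ i₂)
                      {π : Fin (suc m) → Fin m} (isId : IsIdentification i₁ i₂ π) where

  open IsIdentification isId

  i₂≢i₁ : i₂ ≢ i₁
  i₂≢i₁ = i₁≢i₂ ∘ ≡.sym

  edge : Subset (suc m)
  edge = ⁅ i₁ ⁆ ∪ ⁅ i₂ ⁆

  ∈-edge⁻ : ∀ {i} → T (lookup edge i) → i ≡ i₁ ⊎ i ≡ i₂
  ∈-edge⁻ {i} t with to T-∨ (subst T (lookup-∪ ⁅ i₁ ⁆ ⁅ i₂ ⁆ i) t)
  ... | inj₁ i∈⁅i₁⁆ = inj₁ (T-lookup-⁅⁆ i∈⁅i₁⁆)
  ... | inj₂ i∈⁅i₂⁆ = inj₂ (T-lookup-⁅⁆ i∈⁅i₂⁆)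

  i₁∈edge : T (lookup edge i₁)
  i₁∈edge = subst T (≡.sym (lookup-∪ ⁅ i₁ ⁆ ⁅ i₂ ⁆ i₁)) (from T-∨ (inj₁ (T-lookup-⁅self⁆ i₁)))

  i₂∈edge : T (lookup edge i₂)
  i₂∈edge = subst T (≡.sym (lookup-∪ ⁅ i₁ ⁆ ⁅ i₂ ⁆ i₂)) (from T-∨ (inj₂ (T-lookup-⁅self⁆ i₂)))

  ∉-edge : ∀ {i} → i ≢ i₁ → i ≢ i₂ → ¬ T (lookup edge i)
  ∉-edge i≢i₁ i≢i₂ t = [ i≢i₁ , i≢i₂ ]′ (∈-edge⁻ t)

  edge⊆ : (σ : Subset (suc m)) → T (lookup σ i₁) → T (lookup σ i₂) → edge ⊆ σ
  edge⊆ σ i₁∈σ i₂∈σ {i} i∈edge with ∈-edge⁻ (∈⇒T-lookup i∈edge)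
  ... | inj₁ ≡.refl = T-lookup⇒∈ i₁∈σ
  ... | inj₂ ≡.refl = T-lookup⇒∈ i₂∈σ

  ⁅i₁⁆≢edge : ⁅ i₁ ⁆ ≢ edge
  ⁅i₁⁆≢edge eq = i₂≢i₁ (T-lookup-⁅⁆ (subst (λ σ → T (lookup σ i₂)) (≡.sym eq) i₂∈edge))

  fiber-π-i₁ : ∀ {i} → π i ≡ π i₁ → i ≡ i₁ ⊎ i ≡ i₂
  fiber-π-i₁ {i} eq with onlyGlues i i₁ eq
  ... | inj₁ i≡i₁       = inj₁ i≡i₁
  ... | inj₂ (i∈e , _)  = i∈e

  τ : Fin m → Fin (suc m)
  τ k with proj₁ (surjective k) Fin.≟ i₁
  ... | yes _ = i₂
  ... | no  _ = proj₁ (surjective k)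

  πτ : ∀ k → π (τ k) ≡ k
  πτ k with proj₁ (surjective k) Fin.≟ i₁
  ... | yes i≡i₁ = ≡.trans (≡.sym glues) (≡.trans (cong π (≡.sym i≡i₁)) (proj₂ (surjective k)))
  ... | no  _    = proj₂ (surjective k)

  τ≢i₁ : ∀ k → τ k ≢ i₁
  τ≢i₁ k with proj₁ (surjective k) Fin.≟ i₁
  ... | yes _    = i₂≢i₁
  ... | no  i≢i₁ = i≢i₁

  τπ : ∀ {i} → i ≢ i₁ → τ (π i) ≡ i
  τπ {i} i≢i₁ with onlyGlues (τ (π i)) i (πτ (π i))
  ... | inj₁ eq                      = eq
  ... | inj₂ (inj₁ τπi≡i₁ , _)       = ⊥-elim (τ≢i₁ (π i) τπi≡i₁)
  ... | inj₂ (inj₂ _ , inj₁ i≡i₁)    = ⊥-elim (i≢i₁ i≡i₁)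
  ... | inj₂ (inj₂ τπi≡i₂ , inj₂ i≡i₂) = ≡.trans τπi≡i₂ (≡.sym i≡i₂)

  τπi₁ : τ (π i₁) ≡ i₂
  τπi₁ = ≡.trans (cong τ glues) (τπ i₂≢i₁)

  π-punchIn : FinPerm.Permutation m m
  π-punchIn = FinPerm.permutation (π ∘ punchIn i₁) (λ k → punchOut (τ≢i₁ k ∘ ≡.sym))
    (λ k → ≡.trans (cong π (Finₚ.punchIn-punchOut (τ≢i₁ k ∘ ≡.sym))) (πτ k))
    (λ j → ≡.trans (Finₚ.punchOut-cong i₁ (τπ (Finₚ.punchInᵢ≢i i₁ j))) (Finₚ.punchOut-punchIn i₁))

  image-∌ : ∀ σ → ¬ T (lookup σ i₁) → ¬ T (lookup σ i₂) → ¬ T (lookup (image π σ) (π i₁))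
  image-∌ σ i₁∉σ i₂∉σ t with i , i∈σ , πi≡πi₁ ← image⁻ π σ (π i₁) t with fiber-π-i₁ πi≡πi₁
  ... | inj₁ ≡.refl = i₁∉σ i∈σ
  ... | inj₂ ≡.refl = i₂∉σ i∈σ

  image⇒τ : ∀ σ k → π i₁ ≢ k → T (lookup (image π σ) k) → T (lookup σ (τ k))
  image⇒τ σ k πi₁≢k t with i , i∈σ , ≡.refl ← image⁻ π σ k t =
    subst (T ∘ lookup σ) (≡.sym (τπ (πi₁≢k ∘ cong π ∘ ≡.sym))) i∈σ

  τ⇒image : ∀ σ k → T (lookup σ (τ k)) → T (lookup (image π σ) k)
  τ⇒image σ k t = subst (T ∘ lookup (image π σ)) (πτ k) (image⁺ π σ t)

  image-⁅i₁⁆ : image π ⁅ i₁ ⁆ ≡ image π edge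
  image-⁅i₁⁆ = lookup-ext (λ k → T-ext (⊆edge k) (⊇edge k))
    where
    ⊆edge : ∀ k → T (lookup (image π ⁅ i₁ ⁆) k) → T (lookup (image π edge) k)
    ⊆edge k t with i , i∈ , ≡.refl ← image⁻ π ⁅ i₁ ⁆ k t =
      subst (T ∘ lookup (image π edge) ∘ π) (≡.sym (T-lookup-⁅⁆ i∈)) (image⁺ π edge i₁∈edge)
    ⊇edge : ∀ k → T (lookup (image π edge) k) → T (lookup (image π ⁅ i₁ ⁆) k)
    ⊇edge k t with i , i∈ , ≡.refl ← image⁻ π edge k t with ∈-edge⁻ i∈
    ... | inj₁ ≡.refl = image⁺ π ⁅ i₁ ⁆ (T-lookup-⁅self⁆ i₁)
    ... | inj₂ ≡.refl = subst (T ∘ lookup (image π ⁅ i₁ ⁆)) glues (image⁺ π ⁅ i₁ ⁆ (T-lookup-⁅self⁆ i₁))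

-- Deletion and contraction of a maximal edge

module EdgeContraction (F : FiniteField) {m : ℕ} (face : Subset (suc m) → Bool) (isSC : IsSimplicialComplex face)
  {i₁ i₂ : Fin (suc m)} (i₁≢i₂ : i₁ ≢ i₂) (edge∈Δ : T (face (⁅ i₁ ⁆ ∪ ⁅ i₂ ⁆)))
  (edge-maximal : ∀ σ → (⁅ i₁ ⁆ ∪ ⁅ i₂ ⁆) ⊆ σ → T (face σ) → σ ≡ (⁅ i₁ ⁆ ∪ ⁅ i₂ ⁆))
  {π : Fin (suc m) → Fin m} (isId : IsIdentification i₁ i₂ π) where

  open FiniteField F renaming (refl to ≈-refl)
  open Arrangement F
  open Linear F
  open RestrictedChi F
  open Forms F
  open Identification i₁≢i₂ isId
  open IsIdentification isId using (glues)
  open IsSimplicialComplex isSC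
  open import Algebra.Properties.Ring ring using (-‿distribˡ-*)
  open import Algebra.Properties.Group +-group using (inverseˡ-unique)
  private module ≈-Reasoning = SetoidReasoning setoid

  everywhere : ∀ {n} → Vector n → Bool
  everywhere _ = true

  Δ∖e : Subset (suc m) → Bool
  Δ∖e = deleteFace face edge

  A∖e : List (Vector (suc m))
  A∖e = forms Δ∖e

  A/e : List (Vector m)
  A/e = forms (contract π face)

  ∈Δ∖e⁻ : ∀ {σ} → T (Δ∖e σ) → T (face σ) × σ ≢ edge
  ∈Δ∖e⁻ {σ} t with σ∈Δ , σ≢e ← to T-∧ t = σ∈Δ , λ σ≡e → T-not-elim σ≢e (subst (T ∘ subsetEq σ) σ≡e (subsetEq-refl σ))

  ∈Δ∖e⁺ : ∀ {σ} → T (face σ) → σ ≢ edge → T (Δ∖e σ)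
  ∈Δ∖e⁺ σ∈Δ σ≢e = from T-∧ (σ∈Δ , subsetEq-≢ σ≢e)

  not-both-ends : ∀ {σ} → T (face σ) → σ ≢ edge → T (lookup σ i₁) → ¬ T (lookup σ i₂)
  not-both-ends {σ} σ∈Δ σ≢e i₁∈σ i₂∈σ = σ≢e (edge-maximal σ (edge⊆ σ i₁∈σ i₂∈σ) σ∈Δ)

  x₁-form : ∃ λ u → u ∈ A∖e × ∀ x → dot u x ≈ x i₁
  x₁-form
    with u , u∈ , i₁≈u ← forms-cover Δ∖e (∈Δ∖e⁺ (vertices i₁) ⁅i₁⁆≢edge) (isNonempty⁺ ⁅ i₁ ⁆ (T-lookup-⁅self⁆ i₁)) (unit-supported i₁)
    = u , u∈ , λ x → trans (dot-cong {x = x} (sym ∘ i₁≈u) (λ _ → ≈-refl)) (dot-unit i₁ x)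

  edgeForm : Carrier → Vector (suc m)
  edgeForm b i = unit i₁ i + b * unit i₂ i

  edgeForm-i₁ : ∀ b → edgeForm b i₁ ≈ 1#
  edgeForm-i₁ b = trans (+-cong (unit-same i₁) (trans (*-congˡ (unit-other i₂≢i₁)) (zeroʳ b))) (+-identityʳ 1#)

  edgeForm-i₂ : ∀ b → edgeForm b i₂ ≈ b
  edgeForm-i₂ b = trans (+-cong (unit-other i₁≢i₂) (trans (*-congˡ (unit-same i₂)) (*-identityʳ b))) (+-identityˡ b)

  edgeForm-off : ∀ b {i} → i ≢ i₁ → i ≢ i₂ → edgeForm b i ≈ 0#
  edgeForm-off b i≢i₁ i≢i₂ =
    trans (+-cong (unit-other (i≢i₁ ∘ ≡.sym)) (trans (*-congˡ (unit-other (i≢i₂ ∘ ≡.sym))) (zeroʳ b))) (+-identityʳ 0#)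

  dot-edgeForm : ∀ b x → dot (edgeForm b) x ≈ x i₁ + b * x i₂
  dot-edgeForm b x = begin
    dot (edgeForm b) x                              ≈⟨ dot-pair (edgeForm b) x i₁≢i₂ (λ _ → edgeForm-off b) ⟩
    edgeForm b i₁ * x i₁ + edgeForm b i₂ * x i₂     ≈⟨ +-cong (trans (*-congʳ (edgeForm-i₁ b)) (*-identityˡ _)) (*-congʳ (edgeForm-i₂ b)) ⟩
    x i₁ + b * x i₂                                 ∎
    where open ≈-Reasoning

  edgeForm-supported : ∀ {b} → ¬ b ≈ 0# → SupportedOn edge (edgeForm b)
  edgeForm-supported {b} b≉0 i = on , (λ i∉ → edgeForm-off b (i∉ ∘ at i₁∈edge) (i∉ ∘ at i₂∈edge))
    where
    at : ∀ {j} → T (lookup edge j) → i ≡ j → T (lookup edge i)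
    at j∈ ≡.refl = j∈
    on : T (lookup edge i) → ¬ edgeForm b i ≈ 0#
    on i∈ with ∈-edge⁻ i∈
    ... | inj₁ ≡.refl = 1≉0 ∘ trans (sym (edgeForm-i₁ b))
    ... | inj₂ ≡.refl = b≉0 ∘ trans (sym (edgeForm-i₂ b))

  edgeHyperplane : Carrier → Vector (suc m) → Bool
  edgeHyperplane b = everywhere ∩ker edgeForm b

  -- a form f₁x₁ + f₂x₂ on the edge has the kernel of x₁ + (f₂/f₁)x₂
  edge-form-normalise : ∀ {f} → SupportedOn edge f → ∃ λ b → b ∈ nonzeroElems × ker f ⊆ker edgeForm b on everywhere
  edge-form-normalise {f} supp
    with w , f₁w≈1 ← inverse (f i₁) (proj₁ (supp i₁) i₁∈edge)
    with b , b∈ , f₂w≈b ← nonzeroElems-cover (*-≉0 (proj₁ (supp i₂) i₂∈edge) (inverse-≉0 f₁w≈1))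
    = b , b∈ , λ {x} _ t → isZero⁺ (begin
      dot (edgeForm b) x    ≈⟨ dot-edgeForm b x ⟩
      x i₁ + b * x i₂       ≈⟨ +-congˡ (*-congʳ f₂w≈b) ⟨
      x i₁ + (f i₂ * w) * x i₂
        ≈⟨ divide-by-first f₁w≈1 (trans (sym (dot-pair f x i₁≢i₂ (λ i i≢i₁ i≢i₂ → proj₂ (supp i) (∉-edge i≢i₁ i≢i₂))))
                                         (isZero⁻ (proj₂ (to T-∧ t)))) ⟩
      0#                    ∎)
      where open ≈-Reasoning

  chiOn-forms-split : ∀ d → chiOn (forms face) everywhere d ≡ chiOn (map edgeForm nonzeroElems ++ A∖e) everywhere d
  chiOn-forms-split d = chiOn-cover _ _ everywhere d Δ≼split split≼Δ
    where
    Δ≼split : forms face ≼ (map edgeForm nonzeroElems ++ A∖e) on everywhere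
    Δ≼split {f} f∈ with σ , σ∈Δ , σ≢∅ , f∈all , supp ← ∈-forms⁻ face f∈ with Vecₚ.≡-dec _≟ᵇ_ σ edge
    ... | no σ≢e = f , ∈-++⁺ʳ _ (∈-forms⁺ Δ∖e (∈Δ∖e⁺ σ∈Δ σ≢e) σ≢∅ f∈all supp) , ⊆ker-refl f everywhere
    ... | yes ≡.refl with b , b∈ , f⊆b ← edge-form-normalise supp = edgeForm b , ∈-++⁺ˡ (∈-map⁺ edgeForm b∈) , f⊆b
    split≼Δ : (map edgeForm nonzeroElems ++ A∖e) ≼ forms face on everywhere
    split≼Δ {h} h∈ with ∈-++⁻ (map edgeForm nonzeroElems) h∈
    ... | inj₂ h∈A∖e with σ , σ∈Δ∖e , σ≢∅ , h∈all , supp ← ∈-forms⁻ Δ∖e h∈A∖e =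
      h , ∈-forms⁺ face (proj₁ (∈Δ∖e⁻ σ∈Δ∖e)) σ≢∅ h∈all supp , ⊆ker-refl h everywhere
    ... | inj₁ h∈E
      with b , b∈ , ≡.refl ← ∈-map⁻ edgeForm h∈E
      with f , f∈ , b≈f ← forms-cover face edge∈Δ (isNonempty⁺ edge i₁∈edge) (edgeForm-supported (∈-nonzeroElems⁻ b∈))
      = f , f∈ , SameKernel⇒⊆ker {a = edgeForm b} {b = f} {W = everywhere} (λ {x} _ → isZero-cong (dot-cong {x = x} b≈f (λ _ → ≈-refl)))

  -- within the edge hyperplane of a, the edge hyperplanes of all b ≠ a are absorbed by x_{i₁}
  chiOn-delete-edgeForms : ∀ d (bs : List Carrier) → AllPairs (λ x y → ¬ x ≈ y) bs
    → chiOn (map edgeForm bs ++ A∖e) everywhere d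
      ≡ chiOn A∖e everywhere d ℤ.- sumℤ (map (λ b → chiOn A∖e (edgeHyperplane b) d) bs)
  chiOn-delete-edgeForms d []       _ = ≡.sym (ℤₚ.+-identityʳ _)
  chiOn-delete-edgeForms d (a ∷ bs) (a∉bs ∷ bs!) = begin
    chiOn (edgeForm a ∷ map edgeForm bs ++ A∖e) everywhere d
      ≡⟨ chiOn-∷ (edgeForm a) (map edgeForm bs ++ A∖e) everywhere d ⟩
    chiOn (map edgeForm bs ++ A∖e) everywhere d ℤ.- chiOn (map edgeForm bs ++ A∖e) (edgeHyperplane a) d
      ≡⟨ cong₂ ℤ._-_ (chiOn-delete-edgeForms d bs bs!) (chiOn-absorb-++ (map edgeForm bs) A∖e (edgeHyperplane a) d absorbed) ⟩
    (X everywhere ℤ.- S) ℤ.- X (edgeHyperplane a)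
      ≡⟨ solve 3 (λ x s y → (x :- s) :- y := x :- (y :+ s)) ≡.refl (X everywhere) S (X (edgeHyperplane a)) ⟩
    X everywhere ℤ.- (X (edgeHyperplane a) ℤ.+ S) ∎
    where
    open ≡.≡-Reasoning
    open +-*-Solver using (solve; _:=_; _:-_; _:+_)
    X = λ W → chiOn A∖e W d
    S = sumℤ (map (λ b → X (edgeHyperplane b)) bs)
    absorbed : map edgeForm bs ≼ A∖e on edgeHyperplane a
    absorbed h∈ with b , b∈bs , ≡.refl ← ∈-map⁻ edgeForm h∈ with u , u∈ , dot-u ← x₁-form =
      u , u∈ , λ {x} _ t → isZero⁺ (trans (dot-u x) (distinct-lines-meet-at-0 (λ a≈b → All.lookup a∉bs b∈bs a≈b)
        (trans (sym (dot-edgeForm a x)) (isZero⁻ (proj₁ (to T-∧ t))))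
        (trans (sym (dot-edgeForm b x)) (isZero⁻ (proj₂ (to T-∧ t))))))

  -- F^m ≅ edge hyperplane of a, via y ↦ (y ∘ π) with the i₁-entry scaled by -a
  module OnEdgeHyperplane (a : Carrier) where

    open ≈-Reasoning

    scale : Fin (suc m) → Carrier
    scale i = if does (i Fin.≟ i₁) then - a else 1#

    scale-i₁ : scale i₁ ≈ - a
    scale-i₁ = reflexive (if-true (does⁺ (i₁ Fin.≟ i₁) ≡.refl))

    scale-off : ∀ {i} → i ≢ i₁ → scale i ≈ 1#
    scale-off {i} i≢i₁ = reflexive (if-false (T-not-elim (not-does⁺ (i Fin.≟ i₁) i≢i₁)))

    lift : Vector m → Vector (suc m)
    lift y i = scale i * y (π i)

    restrict : Vector (suc m) → Vector m
    restrict x = x ∘ τ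

    pullback : Vector (suc m) → Vector m
    pullback c k = c (τ k) + unit (π i₁) k * (c i₁ * - a)

    lift-cong : Congruent lift
    lift-cong y≈y′ i = *-congˡ (y≈y′ (π i))

    lift-linear : IsLinear lift
    lift-linear c vs i = begin
      scale i * sumF (λ k → c k * vs k (π i))     ≈⟨ sumF-*ˡ (scale i) (λ k → c k * vs k (π i)) ⟨
      sumF (λ k → scale i * (c k * vs k (π i)))   ≈⟨ sumF-cong (λ k → *-swapˡ (scale i) (c k) (vs k (π i))) ⟩
      sumF (λ k → c k * (scale i * vs k (π i)))   ∎

    restrict∘lift : ∀ y → restrict (lift y) ≈ᵛ y
    restrict∘lift y k = trans (*-cong (scale-off (τ≢i₁ k)) (reflexive (cong y (πτ k)))) (*-identityˡ _)

    lift∘restrict : ∀ x → T (edgeHyperplane a x) → lift (restrict x) ≈ᵛ x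
    lift∘restrict x x∈H i = at i (i Fin.≟ i₁)
      where
      at : ∀ i → Dec (i ≡ i₁) → lift (restrict x) i ≈ x i
      at i (no i≢i₁)   = trans (*-cong (scale-off i≢i₁) (reflexive (cong x (τπ i≢i₁)))) (*-identityˡ _)
      at i (yes ≡.refl) = begin
        scale i₁ * x (τ (π i₁))  ≈⟨ *-cong scale-i₁ (reflexive (cong x τπi₁)) ⟩
        - a * x i₂               ≈⟨ -‿distribˡ-* a (x i₂) ⟨
        - (a * x i₂)             ≈⟨ inverseˡ-unique (x i₁) (a * x i₂) (trans (sym (dot-edgeForm a x)) (isZero⁻ x∈H)) ⟨
        x i₁                     ∎

    lift∈edgeHyperplane : ∀ y → T (edgeHyperplane a (lift y))
    lift∈edgeHyperplane y = isZero⁺ (begin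
      dot (edgeForm a) (lift y)                      ≈⟨ dot-edgeForm a (lift y) ⟩
      scale i₁ * y (π i₁) + a * (scale i₂ * y (π i₂))
        ≈⟨ +-cong (*-congʳ scale-i₁) (*-congˡ (trans (*-cong (scale-off i₂≢i₁) (reflexive (cong y (≡.sym glues)))) (*-identityˡ _))) ⟩
      - a * y (π i₁) + a * y (π i₁)                  ≈⟨ distribʳ (y (π i₁)) (- a) a ⟨
      (- a + a) * y (π i₁)                           ≈⟨ *-congʳ (-‿inverseˡ a) ⟩
      0# * y (π i₁)                                  ≈⟨ zeroˡ _ ⟩
      0#                                             ∎)

    dot-lift : ∀ c y → dot c (lift y) ≈ dot (pullback c) y
    dot-lift c y = begin
      sumF (λ i → c i * (scale i * y (π i)))
        ≈⟨ sumF-remove (λ i → c i * (scale i * y (π i))) i₁ ⟩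
      c i₁ * (scale i₁ * y (π i₁)) + sumF (λ j → c (punchIn i₁ j) * (scale (punchIn i₁ j) * y (π (punchIn i₁ j))))
        ≈⟨ +-cong (trans (*-congˡ (*-congʳ scale-i₁)) (sym (*-assoc _ _ _))) (sumF-cong off-i₁) ⟩
      s * y (π i₁) + sumF (λ j → c (τ (π (punchIn i₁ j))) * y (π (punchIn i₁ j)))
        ≈⟨ +-congˡ (sumF-permute (λ k → c (τ k) * y k) π-punchIn) ⟨
      s * y (π i₁) + sumF (λ k → c (τ k) * y k)
        ≈⟨ +-comm _ _ ⟩
      sumF (λ k → c (τ k) * y k) + s * y (π i₁)
        ≈⟨ +-congˡ (*-congˡ (dot-unit (π i₁) y)) ⟨
      sumF (λ k → c (τ k) * y k) + s * sumF (λ k → unit (π i₁) k * y k)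
        ≈⟨ +-congˡ (sumF-*ˡ s (λ k → unit (π i₁) k * y k)) ⟨
      sumF (λ k → c (τ k) * y k) + sumF (λ k → s * (unit (π i₁) k * y k))
        ≈⟨ sumF-+ (λ k → c (τ k) * y k) (λ k → s * (unit (π i₁) k * y k)) ⟨
      sumF (λ k → c (τ k) * y k + s * (unit (π i₁) k * y k))
        ≈⟨ sumF-cong (λ k → +-congˡ (trans (sym (*-assoc s (unit (π i₁) k) (y k))) (*-congʳ (*-comm s (unit (π i₁) k))))) ⟩
      sumF (λ k → c (τ k) * y k + (unit (π i₁) k * s) * y k)
        ≈⟨ sumF-cong (λ k → distribʳ (y k) _ _) ⟨
      dot (pullback c) y ∎
      where
      s = c i₁ * - a
      off-i₁ : ∀ j → c (punchIn i₁ j) * (scale (punchIn i₁ j) * y (π (punchIn i₁ j)))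
                   ≈ c (τ (π (punchIn i₁ j))) * y (π (punchIn i₁ j))
      off-i₁ j = *-cong (reflexive (cong c (≡.sym (τπ (Finₚ.punchInᵢ≢i i₁ j)))))
                        (trans (*-congʳ (scale-off (Finₚ.punchInᵢ≢i i₁ j))) (*-identityˡ _))

    dim-edgeHyperplane : ∀ B → dim (λ x → edgeHyperplane a x ∧ inIntersection B x)
                             ≡ dim (λ y → true ∧ inIntersection (map pullback B) y)
    dim-edgeHyperplane B = ≡.trans
      (dim-transport V V-resp lift-cong (λ x≈x′ → x≈x′ ∘ τ) lift-linear (λ _ _ _ → ≈-refl) restrict∘lift
                     (λ x t → lift∘restrict x (proj₁ (to T-∧ t))))
      (dim-cong (V ∘ lift) (λ y → true ∧ inIntersection (map pullback B) y) (λ {y} _ → ≡.trans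
        (cong (_∧ inIntersection B (lift y)) (to T-≡ (lift∈edgeHyperplane y)))
        (≡.trans (allL-cong B (λ {c} _ → isZero-cong (dot-lift c y))) (≡.sym (allL-map (λ c → isZero (dot c y)) pullback B)))))
      where
      V : Vector (suc m) → Bool
      V x = edgeHyperplane a x ∧ inIntersection B x
      V-resp : Respects≈ V
      V-resp x≈y = cong₂ _∧_ (isZero-cong (dot-cong {a = edgeForm a} (λ _ → ≈-refl) x≈y))
                             (allL-cong B (λ {c} _ → isZero-cong (dot-cong {a = c} (λ _ → ≈-refl) x≈y)))

    chiOn-edgeHyperplane : ∀ L d → chiOn L (edgeHyperplane a) d ≡ chiOn (map pullback L) everywhere d
    chiOn-edgeHyperplane L d = ≡.sym (≡.trans
      (cong (sumℤ ∘ map (term everywhere d)) (sublists-map pullback L))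
      (cong sumℤ (≡.trans (≡.sym (Listₚ.map-∘ (sublists L))) (Listₚ.map-cong (λ B → ≡.sym (cong₂
        (λ k n → if does (k ℕ.≟ d) then sign n else ℤ.0ℤ) (dim-edgeHyperplane B) (≡.sym (Listₚ.length-map pullback B)))) (sublists L)))))

  nonedge-preimage : ∀ {τ′} → T (contract π face τ′) → ∃ λ σ → T (face σ) × σ ≢ edge × image π σ ≡ τ′
  nonedge-preimage {τ′} t with σ , σ∈Δ , πσ≡τ′ ← contract⁻ π face τ′ t with Vecₚ.≡-dec _≟ᵇ_ σ edge
  ... | no σ≢e      = σ , σ∈Δ , σ≢e , πσ≡τ′
  ... | yes ≡.refl  = ⁅ i₁ ⁆ , vertices i₁ , ⁅i₁⁆≢edge , ≡.trans image-⁅i₁⁆ πσ≡τ′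

  -- pullback matches the forms of Δ ∖ e with those of Δ / e; a ≠ 0 keeps the coefficient
  -- c_{i₁}·(−a) of a pulled-back form nonzero
  module OnNonzeroEdgeHyperplane {a : Carrier} (a≉0 : ¬ a ≈ 0#) where

    open OnEdgeHyperplane a
    open ≈-Reasoning

    pullback-cong : Congruent pullback
    pullback-cong c≈c′ k = +-cong (c≈c′ (τ k)) (*-congˡ (*-congʳ (c≈c′ i₁)))

    pullback-πi₁ : ∀ c → pullback c (π i₁) ≈ c i₂ + c i₁ * - a
    pullback-πi₁ c = +-cong (reflexive (cong c τπi₁)) (trans (*-congʳ (unit-same (π i₁))) (*-identityˡ _))

    pullback-off : ∀ c {k} → π i₁ ≢ k → pullback c k ≈ c (τ k)
    pullback-off c πi₁≢k = trans (+-congˡ (trans (*-congʳ (unit-other πi₁≢k)) (zeroˡ _))) (+-identityʳ _)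

    pullback-supported : ∀ {σ c} → T (face σ) → σ ≢ edge → SupportedOn σ c → SupportedOn (image π σ) (pullback c)
    pullback-supported {σ} {c} σ∈Δ σ≢e supp k = at k (π i₁ Fin.≟ k)
      where
      at : ∀ k → Dec (π i₁ ≡ k) → SupportedAt (image π σ) (pullback c) k
      at k (no πi₁≢k) =
          (λ k∈ → proj₁ (supp (τ k)) (image⇒τ σ k πi₁≢k k∈) ∘ trans (sym (pullback-off c πi₁≢k)))
        , (λ k∉ → trans (pullback-off c πi₁≢k) (proj₂ (supp (τ k)) (k∉ ∘ τ⇒image σ k)))
      at _ (yes ≡.refl) with T? (lookup σ i₁) | T? (lookup σ i₂)
      ... | yes i₁∈ | yes i₂∈ = ⊥-elim (not-both-ends σ∈Δ σ≢e i₁∈ i₂∈)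
      ... | yes i₁∈ | no  i₂∉ =
          (λ _ → *-≉0 (proj₁ (supp i₁) i₁∈) (-‿≉0 a≉0)
                 ∘ trans (sym (trans (+-congʳ (proj₂ (supp i₂) i₂∉)) (+-identityˡ _))) ∘ trans (sym (pullback-πi₁ c)))
        , (λ k∉ → ⊥-elim (k∉ (image⁺ π σ i₁∈)))
      ... | no  i₁∉ | yes i₂∈ =
          (λ _ → proj₁ (supp i₂) i₂∈
                 ∘ trans (sym (trans (+-congˡ (trans (*-congʳ (proj₂ (supp i₁) i₁∉)) (zeroˡ _))) (+-identityʳ _)))
                 ∘ trans (sym (pullback-πi₁ c)))
        , (λ k∉ → ⊥-elim (k∉ (subst (T ∘ lookup (image π σ)) (≡.sym glues) (image⁺ π σ i₂∈))))
      ... | no  i₁∉ | no  i₂∉ =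
          (λ k∈ → ⊥-elim (image-∌ σ i₁∉ i₂∉ k∈))
        , (λ _ → trans (pullback-πi₁ c)
                   (trans (+-cong (proj₂ (supp i₂) i₂∉) (trans (*-congʳ (proj₂ (supp i₁) i₁∉)) (zeroˡ _))) (+-identityʳ 0#)))

    private
      w : Carrier
      w = proj₁ (inverse (- a) (-‿≉0 a≉0))

      -aw≈1 : - a * w ≈ 1#
      -aw≈1 = proj₂ (inverse (- a) (-‿≉0 a≉0))

    weight : Fin (suc m) → Carrier
    weight i = if does (i Fin.≟ i₁) then w else 1#

    weight-i₁ : weight i₁ ≈ w
    weight-i₁ = reflexive (if-true (does⁺ (i₁ Fin.≟ i₁) ≡.refl))

    weight-off : ∀ {i} → i ≢ i₁ → weight i ≈ 1#
    weight-off {i} i≢i₁ = reflexive (if-false (T-not-elim (not-does⁺ (i Fin.≟ i₁) i≢i₁)))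

    weight-≉0 : ∀ i → ¬ weight i ≈ 0#
    weight-≉0 i with i Fin.≟ i₁
    ... | yes _ = inverse-≉0 -aw≈1
    ... | no  _ = 1≉0

    extend : Subset (suc m) → Vector m → Vector (suc m)
    extend σ f i = if lookup σ i then f (π i) * weight i else 0#

    extend-in : ∀ σ f {i} → T (lookup σ i) → extend σ f i ≈ f (π i) * weight i
    extend-in σ f i∈ = reflexive (if-true i∈)

    extend-out : ∀ σ f {i} → ¬ T (lookup σ i) → extend σ f i ≈ 0#
    extend-out σ f i∉ = reflexive (if-false i∉)

    extend-supported : ∀ σ {f} → SupportedOn (image π σ) f → SupportedOn σ (extend σ f)
    extend-supported σ {f} supp i =
        (λ i∈ → *-≉0 (proj₁ (supp (π i)) (image⁺ π σ i∈)) (weight-≉0 i) ∘ trans (sym (extend-in σ f i∈)))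
      , extend-out σ f

    pullback-extend : ∀ {σ f} → T (face σ) → σ ≢ edge → SupportedOn (image π σ) f → pullback (extend σ f) ≈ᵛ f
    pullback-extend {σ} {f} σ∈Δ σ≢e supp k = at k (π i₁ Fin.≟ k)
      where
      at : ∀ k → Dec (π i₁ ≡ k) → pullback (extend σ f) k ≈ f k
      at k (no πi₁≢k) with T? (lookup σ (τ k))
      ... | yes τk∈ = trans (pullback-off (extend σ f) πi₁≢k) (trans (extend-in σ f τk∈)
                        (trans (*-cong (reflexive (cong f (πτ k))) (weight-off (τ≢i₁ k))) (*-identityʳ _)))
      ... | no  τk∉ = trans (pullback-off (extend σ f) πi₁≢k)
                        (trans (extend-out σ f τk∉) (sym (proj₂ (supp k) (τk∉ ∘ image⇒τ σ k πi₁≢k))))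
      at _ (yes ≡.refl) with T? (lookup σ i₁) | T? (lookup σ i₂)
      ... | yes i₁∈ | yes i₂∈ = ⊥-elim (not-both-ends σ∈Δ σ≢e i₁∈ i₂∈)
      ... | yes i₁∈ | no  i₂∉ = begin
        pullback (extend σ f) (π i₁)              ≈⟨ pullback-πi₁ (extend σ f) ⟩
        extend σ f i₂ + extend σ f i₁ * - a       ≈⟨ +-cong (extend-out σ f i₂∉) (*-congʳ (trans (extend-in σ f i₁∈) (*-congˡ weight-i₁))) ⟩
        0# + (f (π i₁) * w) * - a                 ≈⟨ +-identityˡ _ ⟩
        (f (π i₁) * w) * - a                      ≈⟨ *-assoc _ _ _ ⟩
        f (π i₁) * (w * - a)                      ≈⟨ *-congˡ (trans (*-comm w (- a)) -aw≈1) ⟩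
        f (π i₁) * 1#                             ≈⟨ *-identityʳ _ ⟩
        f (π i₁)                                  ∎
      ... | no  i₁∉ | yes i₂∈ = begin
        pullback (extend σ f) (π i₁)              ≈⟨ pullback-πi₁ (extend σ f) ⟩
        extend σ f i₂ + extend σ f i₁ * - a
          ≈⟨ +-cong (trans (extend-in σ f i₂∈) (*-congˡ (weight-off i₂≢i₁))) (trans (*-congʳ (extend-out σ f i₁∉)) (zeroˡ _)) ⟩
        f (π i₂) * 1# + 0#                        ≈⟨ trans (+-identityʳ _) (*-identityʳ _) ⟩
        f (π i₂)                                  ≈⟨ reflexive (cong f glues) ⟨
        f (π i₁)                                  ∎
      ... | no  i₁∉ | no  i₂∉ = begin
        pullback (extend σ f) (π i₁)              ≈⟨ pullback-πi₁ (extend σ f) ⟩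
        extend σ f i₂ + extend σ f i₁ * - a       ≈⟨ +-cong (extend-out σ f i₂∉) (trans (*-congʳ (extend-out σ f i₁∉)) (zeroˡ _)) ⟩
        0# + 0#                                   ≈⟨ +-identityʳ 0# ⟩
        0#                                        ≈⟨ proj₂ (supp (π i₁)) (image-∌ σ i₁∉ i₂∉) ⟨
        f (π i₁)                                  ∎

    chiOn-pullback : ∀ d → chiOn (map pullback A∖e) everywhere d ≡ chiOn A/e everywhere d
    chiOn-pullback d = chiOn-cover _ _ everywhere d pullback≼contraction contraction≼pullback
      where
      pullback≼contraction : map pullback A∖e ≼ A/e on everywhere
      pullback≼contraction g∈
        with c , c∈ , ≡.refl ← ∈-map⁻ pullback g∈
        with σ , σ∈Δ∖e , σ≢∅ , _ , supp ← ∈-forms⁻ Δ∖e c∈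
        with i , i∈σ ← isNonempty⁻ σ σ≢∅
        with σ∈Δ , σ≢e ← ∈Δ∖e⁻ σ∈Δ∖e
        with f , f∈ , c≈f ← forms-cover (contract π face) (contract⁺ π face σ∈Δ) (isNonempty⁺ (image π σ) (image⁺ π σ i∈σ))
                                        (pullback-supported σ∈Δ σ≢e supp)
        = f , f∈ , SameKernel⇒⊆ker {a = pullback c} {b = f} {W = everywhere} (λ {x} _ → isZero-cong (dot-cong {x = x} c≈f (λ _ → ≈-refl)))
      contraction≼pullback : A/e ≼ map pullback A∖e on everywhere
      contraction≼pullback {f} f∈
        with τ′ , τ′∈Δ/e , τ′≢∅ , _ , supp ← ∈-forms⁻ (contract π face) f∈
        with σ , σ∈Δ , σ≢e , ≡.refl ← nonedge-preimage τ′∈Δ/e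
        with k , k∈ ← isNonempty⁻ (image π σ) τ′≢∅
        with i , i∈σ , _ ← image⁻ π σ k k∈
        with c , c∈ , extend≈c ← forms-cover Δ∖e (∈Δ∖e⁺ σ∈Δ σ≢e) (isNonempty⁺ σ i∈σ) (extend-supported σ supp)
        = pullback c , ∈-map⁺ pullback c∈ , SameKernel⇒⊆ker {a = f} {b = pullback c} {W = everywhere}
            (λ {x} _ → isZero-cong (dot-cong {x = x} (λ j → trans (sym (pullback-extend {σ} σ∈Δ σ≢e supp j)) (pullback-cong extend≈c j)) (λ _ → ≈-refl)))

    chiOn-edgeHyperplane≡contraction : ∀ d → chiOn A∖e (edgeHyperplane a) d ≡ chiOn A/e everywhere d
    chiOn-edgeHyperplane≡contraction d = ≡.trans (chiOn-edgeHyperplane A∖e d) (chiOn-pullback d)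

open import Data.Integer using (ℤ; +_; _-_; _*_)

mainTheorem2 : (F : FiniteField) (ℓ : ℕ) (face : Subset ℓ → Bool)
    → IsSimplicialComplex face
    → (i₁ i₂ : Fin ℓ) → i₁ ≢ i₂
    → T (face (⁅ i₁ ⁆ ∪ ⁅ i₂ ⁆))
    → (∀ σ → (⁅ i₁ ⁆ ∪ ⁅ i₂ ⁆) ⊆ σ → T (face σ) → σ ≡ (⁅ i₁ ⁆ ∪ ⁅ i₂ ⁆))
    → (π : Fin ℓ → Fin (ℓ ∸ 1)) → IsIdentification i₁ i₂ π
    → (d : ℕ)
    → Arrangement.chiCoeff F face d
      ≡ Arrangement.chiCoeff F (deleteFace face (⁅ i₁ ⁆ ∪ ⁅ i₂ ⁆)) d
        - (+ (FiniteField.order F) - + 1) * Arrangement.chiCoeff F (contract π face) d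
mainTheorem2 F zero    face isSC () i₂ i₁≢i₂ edge∈Δ edge-maximal π isId d
mainTheorem2 F (suc m) face isSC i₁ i₂ i₁≢i₂ edge∈Δ edge-maximal π isId d = begin
  chiCoeff face d
    ≡⟨ chiCoeff≡chiOn face d ⟩
  chiOn (arrangement face) everywhere d
    ≡⟨ chiOn-deduplicate (forms face) everywhere d ⟩
  chiOn (forms face) everywhere d
    ≡⟨ chiOn-forms-split d ⟩
  chiOn (map edgeForm nonzeroElems ++ A∖e) everywhere d
    ≡⟨ chiOn-delete-edgeForms d nonzeroElems nonzeroElems-distinct ⟩
  chiOn A∖e everywhere d - sumℤ (map (λ b → chiOn A∖e (edgeHyperplane b) d) nonzeroElems)
    ≡⟨ cong (chiOn A∖e everywhere d -_) (sumℤ-const _ _ nonzeroElems (λ b∈ →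
         OnNonzeroEdgeHyperplane.chiOn-edgeHyperplane≡contraction (∈-nonzeroElems⁻ b∈) d)) ⟩
  chiOn A∖e everywhere d - + length nonzeroElems * chiOn A/e everywhere d
    ≡⟨ cong₂ (λ x n → x - (+ n - + 1) * chiOn A/e everywhere d)
             (≡.sym (chiOn-deduplicate A∖e everywhere d)) (≡.sym order≡1+|nonzeroElems|) ⟩
  chiCoeff Δ∖e d - (+ order - + 1) * chiOn A/e everywhere d
    ≡⟨ cong (λ x → chiCoeff Δ∖e d - (+ order - + 1) * x) (≡.sym (chiOn-deduplicate A/e everywhere d)) ⟩
  chiCoeff Δ∖e d - (+ order - + 1) * chiCoeff (contract π face) d ∎
  where
  open FiniteField F using (order)
  open Arrangement F using (chiCoeff; arrangement; forms)
  open Linear F using (nonzeroElems; ∈-nonzeroElems⁻; nonzeroElems-distinct; order≡1+|nonzeroElems|)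
  open RestrictedChi F using (chiOn; chiCoeff≡chiOn; chiOn-deduplicate; sumℤ; sumℤ-const)
  open EdgeContraction F face isSC i₁≢i₂ edge∈Δ edge-maximal isId
  open ≡.≡-Reasoning
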